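{- Let $n$ be a positive integer and $p$ a rational prime which splits in $F$. Let $h\in T$, $h\neq0$. Then there exist $a,d\in\mathbf Z_+$ with $p\nmid a$ and $u\in\mathrm{SL}_2(\mathcal O_F)$ such that $u^*hu-\epsilon(h)\begin{pmatrix}a&0\\0&d\end{pmatrix}\in p^nT$.
   Context: $F$ is an imaginary quadratic field with ring of integers $\mathcal O_F$; for a matrix $x$, $x^*=\bar x^t$ where the bar is Galois conjugation. $S(R)=\{h\in M_2(R\otimes\mathcal O_F):h^*=h\}$, $T=\{h\in S(\mathbf Q):\mathrm{tr}(S(\mathbf Z)h)\subset\mathbf Z\}$, $T_\ell=\{h\in S(\mathbf Q_\ell):\mathrm{tr}(S(\mathbf Z_\ell)h)\subset\mathbf Z_\ell\}$ for primes $\ell$. For $h\in T$ with images $h_\ell\in T_\ell$, $\epsilon_\ell(h)=\max\{m\in\mathbf Z:\ell^{ -m}h_\ell\in T_\ell\}$ and $\epsilon(h)=\prod_\ell\ell^{\epsilon_\ell(h)}$. -}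

module Defs where

open import Data.Nat as ℕ using (ℕ; suc; zero)
import Data.Nat.Properties as ℕP
open import Data.Nat.Primality using (Prime)
open import Data.Nat.Divisibility using (_∣_)
open import Data.Integer as ℤ using (ℤ; +_; -[1+_])
open import Data.Integer.Divisibility using () renaming (_∣_ to _∣ℤ_)
open import Data.Rational as ℚ using (ℚ; ↧ₙ_; _/_)
open import Data.Product using (_×_; Σ; ∃; ∃-syntax; _,_)
open import Data.Sum using (_⊎_)
open import Relation.Nullary using (¬_)
open import Relation.Binary.PropositionalEquality using (_≡_; _≢_)
open import Function.Bundles using (_⇔_)

-- The imaginary quadratic field F, given by its (fundamental,
-- negative) discriminant D.  O_F = ℤ[ω], ω = (D + √D)/2, so that
--   ω² = D ω - (D² - D)/4 ,   ω̄ = D - ω .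

SquareFree : ℤ → Set
SquareFree m = ∀ (k : ℕ) → (+ (k ℕ.* k)) ∣ℤ m → k ≡ 1

infix 4 _≡ᶻ_mod_
_≡ᶻ_mod_ : ℤ → ℤ → ℤ → Set
x ≡ᶻ y mod m = m ∣ℤ (x ℤ.- y)

ImagQuadDisc : ℤ → Set
ImagQuadDisc D =
  (D ℤ.< + 0) ×
  ( (D ≡ᶻ + 1 mod + 4 × SquareFree D)
  ⊎ (∃[ m ] (D ≡ + 4 ℤ.* m) × ((m ≡ᶻ + 2 mod + 4) ⊎ (m ≡ᶻ + 3 mod + 4)) × SquareFree m) )

module Field (D : ℤ) where

  -- the integer (D² - D)/4 = ω ω̄ (as a rational, to avoid division)
  Nω : ℚ
  Nω = ((D ℤ.* D) ℤ.- D) / 4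

  Dq : ℚ
  Dq = D / 1

  zq : ℤ → ℚ
  zq z = z / 1

  record F : Set where
    constructor _+_ω
    field re im : ℚ
  open F public

  record OF : Set where
    constructor _+_ω'
    field reZ imZ : ℤ
  open OF public

  ι : OF → F
  ι (x + y ω') = zq x + zq y ω

  0F 1F : F
  0F = ℚ.0ℚ + ℚ.0ℚ ω
  1F = ℚ.1ℚ + ℚ.0ℚ ω

  ofℚ : ℚ → F
  ofℚ q = q + ℚ.0ℚ ω

  _⊕_ : F → F → F
  (x + y ω) ⊕ (x' + y' ω) = (x ℚ.+ x') + (y ℚ.+ y') ω

  ⊖_ : F → F
  ⊖ (x + y ω) = (ℚ.- x) + (ℚ.- y) ω

  _⊛_ : F → F → F
  (x + y ω) ⊛ (x' + y' ω) =
    (x ℚ.* x' ℚ.- y ℚ.* y' ℚ.* Nω) + (x ℚ.* y' ℚ.+ y ℚ.* x' ℚ.+ y ℚ.* y' ℚ.* Dq) ω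

  conj : F → F
  conj (x + y ω) = (x ℚ.+ y ℚ.* Dq) + (ℚ.- y) ω

  record M2 (A : Set) : Set where
    constructor mat
    field e11 e12 e21 e22 : A
  open M2 public

  _·_ : M2 F → M2 F → M2 F
  mat a b c d · mat a' b' c' d' =
    mat ((a ⊛ a') ⊕ (b ⊛ c')) ((a ⊛ b') ⊕ (b ⊛ d'))
        ((c ⊛ a') ⊕ (d ⊛ c')) ((c ⊛ b') ⊕ (d ⊛ d'))

  _⊟_ : M2 F → M2 F → M2 F
  mat a b c d ⊟ mat a' b' c' d' =
    mat (a ⊕ (⊖ a')) (b ⊕ (⊖ b')) (c ⊕ (⊖ c')) (d ⊕ (⊖ d'))

  _•_ : ℚ → M2 F → M2 F
  q • mat a b c d = mat (ofℚ q ⊛ a) (ofℚ q ⊛ b) (ofℚ q ⊛ c) (ofℚ q ⊛ d)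

  _* : M2 F → M2 F
  mat a b c d * = mat (conj a) (conj c) (conj b) (conj d)

  tr : M2 F → F
  tr (mat a _ _ d) = a ⊕ d

  ιM : M2 OF → M2 F
  ιM (mat a b c d) = mat (ι a) (ι b) (ι c) (ι d)

  det : M2 F → F
  det (mat a b c d) = (a ⊛ d) ⊕ (⊖ (b ⊛ c))

  SL2 : M2 OF → Set
  SL2 u = det (ιM u) ≡ 1F

  -- Hermitian matrices.  S(ℚ): h = (a b; b̄ c), a c ∈ ℚ, b ∈ F.
  record SQ : Set where
    constructor herm
    field ha : ℚ
          hb : F
          hc : ℚ
  open SQ public

  0S : SQ
  0S = herm ℚ.0ℚ 0F ℚ.0ℚ

  toM : SQ → M2 F
  toM (herm a b c) = mat (ofℚ a) b (conj b) (ofℚ c)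

  record SZ : Set where
    constructor hermZ
    field za : ℤ
          zb : OF
          zc : ℤ

  ιS : SZ → SQ
  ιS (hermZ a b c) = herm (zq a) (ι b) (zq c)

  IsInt : F → Set
  IsInt x = ∃[ z ] x ≡ ofℚ (zq z)

  InT : SQ → Set
  InT h = ∀ (g : SZ) → IsInt (tr (toM (ιS g) · toM h))

  InZℓ : ℕ → F → Set
  InZℓ ℓ x = ∃[ q ] (x ≡ ofℚ q) × ¬ (ℓ ∣ (↧ₙ q))

  invPow : ℕ → ℕ → ℚ
  invPow zero    m = ℚ.0ℚ
  invPow (suc l) m = (+ 1 / (suc l ℕ.^ m)) {{ℕP.m^n≢0 (suc l) m}}

  -- ℓ^{-m} h_ℓ ∈ T_ℓ  (tested against S(ℤ), which is dense in S(ℤ_ℓ))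
  InTℓ : ℕ → ℕ → SQ → Set
  InTℓ ℓ m h = ∀ (g : SZ) → InZℓ ℓ (tr (toM (ιS g) · (invPow ℓ m • toM h)))

  -- N = ε(h) = ∏_ℓ ℓ^{ε_ℓ(h)}: N ≥ 1 and for each prime ℓ and m ≥ 0,
  -- ℓ^m ∣ N  iff  ℓ^{-m} h_ℓ ∈ T_ℓ  (i.e. v_ℓ(N) = ε_ℓ(h) = max such m).
  IsEpsilon : SQ → ℕ → Set
  IsEpsilon h N = (1 ℕ.≤ N) × (∀ (ℓ : ℕ) → Prime ℓ → ∀ (m : ℕ) → ((ℓ ℕ.^ m) ∣ N) ⇔ InTℓ ℓ m h)

  -- p splits in F: the minimal polynomial X² - D X + (D²-D)/4 of ω has
  -- two distinct roots mod p (Dedekind–Kummer; O_F = ℤ[ω]).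
  Splits : ℕ → Set
  Splits p = Prime p × ∃[ r ] ∃[ s ] (¬ (r ≡ᶻ s mod (+ p))) × IsRoot r × IsRoot s
    where
    IsRoot : ℤ → Set
    IsRoot r = ∃[ k ] (zq (r ℤ.* r ℤ.- D ℤ.* r) ℚ.+ Nω) ≡ zq (+ p ℤ.* k)

  diag : ℕ → ℕ → ℕ → M2 F
  diag e a d = mat (ofℚ (zq (+ (e ℕ.* a)))) 0F 0F (ofℚ (zq (+ (e ℕ.* d))))

  InPowT : ℕ → ℕ → M2 F → Set
  InPowT p n X = ∃[ k ] InT k × X ≡ (zq (+ (p ℕ.^ n)) • toM k)

{-# OPTIONS --safe #-}
module Submission where

-- Write h = (a b; b̄ c). Pairing with S(ℤ) identifies T with ℤ⁴ via the coordinates (a, c, Tr b, Tr (ω b)),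
-- and ε_ℓ(h) is the ℓ-adic valuation of their gcd: if ε(h) = pᵉ N′ with p ∤ N′, then pᵉ divides every
-- coordinate but pᵉ⁺¹ does not divide all of them. Hence one of the unimodular first columns (1,0), (0,1),
-- (1,1), (1,ω) makes the corner A₀ of u₀* h u₀ exactly divisible by pᵉ. As p splits, p ∤ D, the
-- discriminant of the trace form of O_F, so a shear (1 z; 0 1) moves both trace coordinates of the
-- off-diagonal entry into pᵉ⁺ⁿ ℤ. Finally, N′ being invertible modulo p, the diagonal entries are
-- congruent to ε(h) a and ε(h) d modulo pᵉ⁺ⁿ for suitable a, d > 0 with p ∤ a.

open import Defs
open import Data.Nat using (ℕ; _≤_; _^_)
open import Data.Nat.Divisibility using (_∣_)
open import Data.Integer using (ℤ)
open import Data.Product using (_×_; ∃-syntax)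
open import Relation.Nullary using (¬_)
open import Relation.Binary.PropositionalEquality using (_≡_)

open import Algebra.Bundles using (CommutativeRing)
open import Algebra.Consequences.Propositional using (comm∧distrˡ⇒distrʳ)
import Algebra.Solver.Ring.AlmostCommutativeRing as Coefficient-ACR
open import Data.Empty using (⊥-elim)
import Data.Integer
open import Data.Integer as ℤ using (+_; -[1+_])
import Data.Integer.DivMod as ℤDM
open import Data.Integer.Divisibility.Signed as ℤ∣ using (divides)
import Data.Integer.GCD as ℤGCD
import Data.Integer.Properties as ℤP
import Data.Integer.Tactic.RingSolver as ℤ-Solver
open import Data.Maybe using (Maybe; just; nothing)
import Data.Maybe as Maybe
open import Data.Nat as ℕ using (suc; zero)
open import Data.Nat.Coprimality using (Coprime; coprime-Bézout)
open import Data.Nat.Divisibility as ℕ∣ using (divides)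
open import Data.Nat.GCD using (module Bézout)
open import Data.Nat.Induction using (<-rec)
open import Data.Nat.Primality using (Prime; euclidsLemma; prime⇒irreducible; prime⇒nonZero; prime⇒nonTrivial; ¬prime[0]; ¬prime[1])
import Data.Nat.Properties as ℕP
open import Data.Product using (∃; _,_; proj₁; proj₂)
import Data.Rational
open import Data.Rational as ℚ using (ℚ; 0ℚ; 1ℚ; ↥_; ↧_; ↧ₙ_)
import Data.Rational.Properties as ℚP
open import Data.Rational.Unnormalised as ℚᵘ using (mkℚᵘ; *≡*)
import Data.Rational.Unnormalised.Properties as ℚᵘP
open import Data.Sum using (_⊎_; inj₁; inj₂; [_,_]′)
open import Function using (_∘_; id)
open import Function.Bundles using (_⇔_; mk⇔; Equivalence)
open import Relation.Binary.Consequences using (dec⇒weaklyDec)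
open import Relation.Binary.PropositionalEquality using (refl; sym; trans; cong; cong₂; subst; isEquivalence; module ≡-Reasoning)
open import Relation.Nullary using (yes; no)
import Tactic.RingSolver as Solver
import Tactic.RingSolver.Core.AlmostCommutativeRing as ACR

ℚ-ring : ACR.AlmostCommutativeRing _ _
ℚ-ring = ACR.fromCommutativeRing ℚP.+-*-commutativeRing zero?
  where
  zero? : (x : ℚ) → Maybe (0ℚ ≡ x)
  zero? x with 0ℚ ℚP.≟ x
  ... | yes 0≡x = just 0≡x
  ... | no _    = nothing

fromℤ : ℤ → ℚ
fromℤ z = z ℚ./ 1

toℚᵘ-fromℤ : ∀ z → ℚ.toℚᵘ (fromℤ z) ℚᵘ.≃ mkℚᵘ z 0
toℚᵘ-fromℤ z = ℚP.toℚᵘ-fromℚᵘ (mkℚᵘ z 0)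

fromℤ-homo-+ : ∀ m n → fromℤ (m ℤ.+ n) ≡ fromℤ m ℚ.+ fromℤ n
fromℤ-homo-+ m n = ℚP.toℚᵘ-injective (begin
  ℚ.toℚᵘ (fromℤ (m ℤ.+ n))                ≈⟨ toℚᵘ-fromℤ (m ℤ.+ n) ⟩
  mkℚᵘ (m ℤ.+ n) 0                          ≈⟨ *≡* (eq m n) ⟩
  mkℚᵘ m 0 ℚᵘ.+ mkℚᵘ n 0                    ≈⟨ ℚᵘP.+-cong (toℚᵘ-fromℤ m) (toℚᵘ-fromℤ n) ⟨
  ℚ.toℚᵘ (fromℤ m) ℚᵘ.+ ℚ.toℚᵘ (fromℤ n)    ≈⟨ ℚP.toℚᵘ-homo-+ (fromℤ m) (fromℤ n) ⟨
  ℚ.toℚᵘ (fromℤ m ℚ.+ fromℤ n)              ∎)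
  where
  open ℚᵘP.≃-Reasoning
  eq : ∀ m n → (m ℤ.+ n) ℤ.* + 1 ≡ (m ℤ.* + 1 ℤ.+ n ℤ.* + 1) ℤ.* + 1
  eq = ℤ-Solver.solve-∀

fromℤ-homo-* : ∀ m n → fromℤ (m ℤ.* n) ≡ fromℤ m ℚ.* fromℤ n
fromℤ-homo-* m n = ℚP.toℚᵘ-injective (begin
  ℚ.toℚᵘ (fromℤ (m ℤ.* n))                ≈⟨ toℚᵘ-fromℤ (m ℤ.* n) ⟩
  mkℚᵘ (m ℤ.* n) 0                          ≈⟨ *≡* refl ⟩
  mkℚᵘ m 0 ℚᵘ.* mkℚᵘ n 0                    ≈⟨ ℚᵘP.*-cong (toℚᵘ-fromℤ m) (toℚᵘ-fromℤ n) ⟨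
  ℚ.toℚᵘ (fromℤ m) ℚᵘ.* ℚ.toℚᵘ (fromℤ n)    ≈⟨ ℚP.toℚᵘ-homo-* (fromℤ m) (fromℤ n) ⟨
  ℚ.toℚᵘ (fromℤ m ℚ.* fromℤ n)              ∎)
  where open ℚᵘP.≃-Reasoning

fromℤ-homo‿- : ∀ m → fromℤ (ℤ.- m) ≡ ℚ.- fromℤ m
fromℤ-homo‿- m = ℚP.toℚᵘ-injective (begin
  ℚ.toℚᵘ (fromℤ (ℤ.- m))      ≈⟨ toℚᵘ-fromℤ (ℤ.- m) ⟩
  ℚᵘ.- mkℚᵘ m 0                ≈⟨ ℚᵘP.-‿cong (toℚᵘ-fromℤ m) ⟨
  ℚᵘ.- ℚ.toℚᵘ (fromℤ m)        ≈⟨ ℚP.toℚᵘ-homo‿- (fromℤ m) ⟨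
  ℚ.toℚᵘ (ℚ.- fromℤ m)         ∎)
  where open ℚᵘP.≃-Reasoning

fromℤ-homo-- : ∀ m n → fromℤ (m ℤ.- n) ≡ fromℤ m ℚ.- fromℤ n
fromℤ-homo-- m n = trans (fromℤ-homo-+ m (ℤ.- n)) (cong (fromℤ m ℚ.+_) (fromℤ-homo‿- n))

fromℤ-homo-linear₃ : ∀ a s c t p → fromℤ (a ℤ.* s ℤ.+ c ℤ.* t ℤ.+ p) ≡ fromℤ a ℚ.* fromℤ s ℚ.+ fromℤ c ℚ.* fromℤ t ℚ.+ fromℤ p
fromℤ-homo-linear₃ a s c t p =
  trans (fromℤ-homo-+ (a ℤ.* s ℤ.+ c ℤ.* t) p)
    (cong (ℚ._+ fromℤ p) (trans (fromℤ-homo-+ (a ℤ.* s) (c ℤ.* t)) (cong₂ ℚ._+_ (fromℤ-homo-* a s) (fromℤ-homo-* c t))))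

fromℤ-homo-linear₄ : ∀ a s c t p q → fromℤ (a ℤ.* s ℤ.+ c ℤ.* t ℤ.+ (p ℤ.+ q))
                                    ≡ fromℤ a ℚ.* fromℤ s ℚ.+ fromℤ c ℚ.* fromℤ t ℚ.+ (fromℤ p ℚ.+ fromℤ q)
fromℤ-homo-linear₄ a s c t p q = trans (fromℤ-homo-linear₃ a s c t (p ℤ.+ q)) (cong (fromℤ a ℚ.* fromℤ s ℚ.+ fromℤ c ℚ.* fromℤ t ℚ.+_) (fromℤ-homo-+ p q))

fromℤ-injective : ∀ {m n} → fromℤ m ≡ fromℤ n → m ≡ n
fromℤ-injective {m} {n} eq with ℚᵘP.≃-trans (ℚᵘP.≃-sym (toℚᵘ-fromℤ m)) (ℚᵘP.≃-trans (ℚP.toℚᵘ-cong eq) (toℚᵘ-fromℤ n))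
... | *≡* m*1≡n*1 = trans (sym (ℤP.*-identityʳ m)) (trans m*1≡n*1 (ℤP.*-identityʳ n))

↧ₙ-fromℤ : ∀ z → ↧ₙ fromℤ z ≡ 1
↧ₙ-fromℤ z = ℕP.m*n≡1⇒m≡1 (↧ₙ fromℤ z) ℤ.∣ ℤGCD.gcd z (+ 1) ∣
  (trans (sym (ℤP.abs-* (↧ fromℤ z) (ℤGCD.gcd z (+ 1)))) (cong ℤ.∣_∣ (ℚP.↧-/ z 1)))

1/n*fromℤ[n*z]≡fromℤ[z] : ∀ n .{{_ : ℕ.NonZero n}} z → (+ 1 ℚ./ n) ℚ.* fromℤ (+ n ℤ.* z) ≡ fromℤ z
1/n*fromℤ[n*z]≡fromℤ[z] (suc k) z = ℚP.toℚᵘ-injective (begin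
  ℚ.toℚᵘ ((+ 1 ℚ./ suc k) ℚ.* fromℤ (+ suc k ℤ.* z))         ≈⟨ ℚP.toℚᵘ-homo-* (+ 1 ℚ./ suc k) (fromℤ (+ suc k ℤ.* z)) ⟩
  ℚ.toℚᵘ (+ 1 ℚ./ suc k) ℚᵘ.* ℚ.toℚᵘ (fromℤ (+ suc k ℤ.* z)) ≈⟨ ℚᵘP.*-cong (ℚP.toℚᵘ-fromℚᵘ (mkℚᵘ (+ 1) k)) (toℚᵘ-fromℤ (+ suc k ℤ.* z)) ⟩
  mkℚᵘ (+ 1) k ℚᵘ.* mkℚᵘ (+ suc k ℤ.* z) 0                    ≈⟨ *≡* (eq (+ suc k) z) ⟩
  mkℚᵘ z 0                                                     ≈⟨ toℚᵘ-fromℤ z ⟨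
  ℚ.toℚᵘ (fromℤ z)                                             ∎)
  where
  open ℚᵘP.≃-Reasoning
  eq : ∀ n z → (+ 1 ℤ.* (n ℤ.* z)) ℤ.* + 1 ≡ z ℤ.* (n ℤ.* + 1)
  eq = ℤ-Solver.solve-∀

[4z]/4≡fromℤ[z] : ∀ z → (+ 4 ℤ.* z) ℚ./ 4 ≡ fromℤ z
[4z]/4≡fromℤ[z] z = ℚP.toℚᵘ-injective (begin
  ℚ.toℚᵘ ((+ 4 ℤ.* z) ℚ./ 4)   ≈⟨ ℚP.toℚᵘ-fromℚᵘ (mkℚᵘ (+ 4 ℤ.* z) 3) ⟩
  mkℚᵘ (+ 4 ℤ.* z) 3           ≈⟨ *≡* (eq z) ⟩
  mkℚᵘ z 0                     ≈⟨ toℚᵘ-fromℤ z ⟨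
  ℚ.toℚᵘ (fromℤ z)             ∎)
  where
  open ℚᵘP.≃-Reasoning
  eq : ∀ z → (+ 4 ℤ.* z) ℤ.* + 1 ≡ z ℤ.* + 4
  eq = ℤ-Solver.solve-∀

1/n*fromℤ[L]≡q⇒n∣L*↧q : ∀ n .{{_ : ℕ.NonZero n}} L q → q ≡ (+ 1 ℚ./ n) ℚ.* fromℤ L → + n ℤ∣.∣ L ℤ.* ↧ q
1/n*fromℤ[L]≡q⇒n∣L*↧q (suc k) L q@record{} q≡
  with ℚᵘP.≃-trans (ℚP.toℚᵘ-cong q≡) (ℚᵘP.≃-trans (ℚP.toℚᵘ-homo-* (+ 1 ℚ./ suc k) (fromℤ L))
                                                (ℚᵘP.*-cong (ℚP.toℚᵘ-fromℚᵘ (mkℚᵘ (+ 1) k)) (toℚᵘ-fromℤ L)))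
... | *≡* eq = divides (↥ q) (sym (trans (cong (λ t → ↥ q ℤ.* + suc t) (sym (ℕP.*-identityʳ k)))
                                         (trans eq (cong (ℤ._* ↧ q) (ℤP.*-identityˡ L)))))

-- Prime divisibility and inverses modulo prime powers

m∣m^n : ∀ m {n} → 1 ℕ.≤ n → m ℕ∣.∣ m ^ n
m∣m^n m {suc n} _ = ℕ∣.m∣m*n (m ^ n)

prime^e∣m*d⇒prime^e∣m : ∀ {p d} → Prime p → ¬ p ℕ∣.∣ d → ∀ e {m} → p ^ e ℕ∣.∣ m ℕ.* d → p ^ e ℕ∣.∣ m
prime^e∣m*d⇒prime^e∣m pr p∤d zero _ = ℕ∣.1∣ _
prime^e∣m*d⇒prime^e∣m {p} {d} pr p∤d (suc e) {m} pᵉ⁺¹∣md with euclidsLemma m d pr (ℕ∣.∣-trans (ℕ∣.m∣m*n (p ^ e)) pᵉ⁺¹∣md)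
... | inj₂ p∣d = ⊥-elim (p∤d p∣d)
... | inj₁ (divides q refl) = subst (ℕ∣._∣ q ℕ.* p) (ℕP.*-comm (p ^ e) p) (ℕ∣.*-monoˡ-∣ p pᵉ∣q)
  where
  instance _ = prime⇒nonZero pr
  pᵉ∣q : p ^ e ℕ∣.∣ q
  pᵉ∣q = prime^e∣m*d⇒prime^e∣m pr p∤d e (ℕ∣.*-cancelˡ-∣ p
    (subst (p ℕ.* p ^ e ℕ∣.∣_) (trans (cong (ℕ._* d) (ℕP.*-comm q p)) (ℕP.*-assoc p q d)) pᵉ⁺¹∣md))

prime^[1+e]∤prime^e*m : ∀ {p m} → Prime p → ¬ p ℕ∣.∣ m → ∀ e → ¬ p ^ suc e ℕ∣.∣ p ^ e ℕ.* m
prime^[1+e]∤prime^e*m {p} {m} pr p∤m e pᵉ⁺¹∣pᵉm =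
  p∤m (ℕ∣.*-cancelˡ-∣ (p ^ e) {{ℕP.m^n≢0 p e {{prime⇒nonZero pr}}}} (subst (ℕ∣._∣ p ^ e ℕ.* m) (ℕP.*-comm p (p ^ e)) pᵉ⁺¹∣pᵉm))

pow∣numerator : ∀ {ℓ} → Prime ℓ → ∀ m .{{_ : ℕ.NonZero (ℓ ^ m)}} L q → q ≡ (+ 1 ℚ./ ℓ ^ m) ℚ.* fromℤ L → ¬ ℓ ℕ∣.∣ ↧ₙ q →
                + (ℓ ^ m) ℤ∣.∣ L
pow∣numerator {ℓ} pr m L q q≡ ℓ∤↧q = ℤ∣.∣ᵤ⇒∣ (prime^e∣m*d⇒prime^e∣m pr ℓ∤↧q m
  (subst (ℓ ^ m ℕ∣.∣_) (ℤP.abs-* L (↧ q)) (ℤ∣.∣⇒∣ᵤ (1/n*fromℤ[L]≡q⇒n∣L*↧q (ℓ ^ m) L q q≡))))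

euclidᶻ : ∀ {p} → Prime p → ∀ m n → + p ℤ∣.∣ m ℤ.* n → + p ℤ∣.∣ m ⊎ + p ℤ∣.∣ n
euclidᶻ pr m n p∣mn with euclidsLemma ℤ.∣ m ∣ ℤ.∣ n ∣ pr (subst (_ ℕ∣.∣_) (ℤP.abs-* m n) (ℤ∣.∣⇒∣ᵤ p∣mn))
... | inj₁ p∣m = inj₁ (ℤ∣.∣ᵤ⇒∣ p∣m)
... | inj₂ p∣n = inj₂ (ℤ∣.∣ᵤ⇒∣ p∣n)

inverse-mod-prime : ∀ {p} → Prime p → ∀ x → ¬ + p ℤ∣.∣ x → ∃[ l ] + p ℤ∣.∣ l ℤ.* x ℤ.- + 1
inverse-mod-prime {p} pr x p∤x with ℤ∣.m∣∣m∣ {x}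
... | divides s ∣x∣≡s*x = l ℤ.* s , subst (λ t → + p ℤ∣.∣ t ℤ.- + 1) (trans (cong (l ℤ.*_) ∣x∣≡s*x) (sym (ℤP.*-assoc l s x))) p∣l∣x∣-1
  where
  p⊥∣x∣ : Coprime p ℤ.∣ x ∣
  p⊥∣x∣ (d∣p , d∣x) with prime⇒irreducible pr d∣p
  ... | inj₁ d≡1 = d≡1
  ... | inj₂ refl = ⊥-elim (p∤x (ℤ∣.∣ᵤ⇒∣ d∣x))
  toℤ : ∀ {y z w v} → 1 ℕ.+ y ℕ.* z ≡ w ℕ.* v → + 1 ℤ.+ + y ℤ.* + z ≡ + w ℤ.* + v
  toℤ {y} {z} {w} {v} eq = begin
    + 1 ℤ.+ + y ℤ.* + z  ≡⟨ cong (ℤ._+_ (+ 1)) (ℤP.pos-* y z) ⟨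
    + (1 ℕ.+ y ℕ.* z)    ≡⟨ cong +_ eq ⟩
    + (w ℕ.* v)          ≡⟨ ℤP.pos-* w v ⟩
    + w ℤ.* + v          ∎
    where open ≡-Reasoning
  inverse-of-∣x∣ : Bézout.Identity 1 p ℤ.∣ x ∣ → ∃[ l ] + p ℤ∣.∣ l ℤ.* + ℤ.∣ x ∣ ℤ.- + 1
  inverse-of-∣x∣ (Bézout.+- a b eq) = ℤ.- + b , divides (ℤ.- + a) (rearranged (+ a) (+ b) _ _ (toℤ {b} {ℤ.∣ x ∣} {a} {p} eq))
    where
    rearranged : ∀ a b y p → + 1 ℤ.+ b ℤ.* y ≡ a ℤ.* p → ℤ.- b ℤ.* y ℤ.- + 1 ≡ ℤ.- a ℤ.* p
    rearranged a b y p eq = trans (negate a b y) (trans (cong ℤ.-_ eq) (ℤP.neg-distribˡ-* a p))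
      where
      negate : ∀ a b y → ℤ.- b ℤ.* y ℤ.- + 1 ≡ ℤ.- (+ 1 ℤ.+ b ℤ.* y)
      negate = ℤ-Solver.solve-∀
  inverse-of-∣x∣ (Bézout.-+ a b eq) = + b , divides (+ a) (rearranged (+ a) (+ b) _ _ (toℤ {a} {p} {b} {ℤ.∣ x ∣} eq))
    where
    rearranged : ∀ a b y p → + 1 ℤ.+ a ℤ.* p ≡ b ℤ.* y → b ℤ.* y ℤ.- + 1 ≡ a ℤ.* p
    rearranged a b y p eq = trans (cong (ℤ._- + 1) (sym eq)) (cancel a p)
      where
      cancel : ∀ a p → + 1 ℤ.+ a ℤ.* p ℤ.- + 1 ≡ a ℤ.* p
      cancel = ℤ-Solver.solve-∀
  l = proj₁ (inverse-of-∣x∣ (coprime-Bézout p⊥∣x∣))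
  p∣l∣x∣-1 = proj₂ (inverse-of-∣x∣ (coprime-Bézout p⊥∣x∣))

-- Hensel-style lifting: if l inverts x modulo pᵏ and l₀ modulo p, then l - l₀ (l x - 1) inverts it modulo pᵏ⁺¹.
inverse-mod-prime^ : ∀ {p} → Prime p → ∀ x → ¬ + p ℤ∣.∣ x → ∀ k → ∃[ l ] + (p ^ k) ℤ∣.∣ l ℤ.* x ℤ.- + 1
inverse-mod-prime^ pr x p∤x zero = + 0 , divides (ℤ.- + 1) refl
inverse-mod-prime^ {p} pr x p∤x (suc k) with inverse-mod-prime pr x p∤x | inverse-mod-prime^ pr x p∤x k
... | l₀ , divides r l₀x-1≡rp | l , divides q lx-1≡qpᵏ =
  l ℤ.- l₀ ℤ.* (l ℤ.* x ℤ.- + 1) , divides (ℤ.- (q ℤ.* r)) (begin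
    (l ℤ.- l₀ ℤ.* (l ℤ.* x ℤ.- + 1)) ℤ.* x ℤ.- + 1   ≡⟨ factor l l₀ x ⟩
    ℤ.- ((l ℤ.* x ℤ.- + 1) ℤ.* (l₀ ℤ.* x ℤ.- + 1))  ≡⟨ cong₂ (λ s t → ℤ.- (s ℤ.* t)) lx-1≡qpᵏ l₀x-1≡rp ⟩
    ℤ.- ((q ℤ.* + (p ^ k)) ℤ.* (r ℤ.* + p))         ≡⟨ regroup q r (+ p) (+ (p ^ k)) ⟩
    ℤ.- (q ℤ.* r) ℤ.* (+ p ℤ.* + (p ^ k))           ≡⟨ cong (ℤ.- (q ℤ.* r) ℤ.*_) (ℤP.pos-* p (p ^ k)) ⟨
    ℤ.- (q ℤ.* r) ℤ.* + (p ^ suc k)                 ∎)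
  where
  open ≡-Reasoning
  factor : ∀ l l₀ x → (l ℤ.- l₀ ℤ.* (l ℤ.* x ℤ.- + 1)) ℤ.* x ℤ.- + 1 ≡ ℤ.- ((l ℤ.* x ℤ.- + 1) ℤ.* (l₀ ℤ.* x ℤ.- + 1))
  factor = ℤ-Solver.solve-∀
  regroup : ∀ q r p pᵏ → ℤ.- ((q ℤ.* pᵏ) ℤ.* (r ℤ.* p)) ≡ ℤ.- (q ℤ.* r) ℤ.* (p ℤ.* pᵏ)
  regroup = ℤ-Solver.solve-∀

prime-power-factor : ∀ {p} → Prime p → ∀ N → 1 ℕ.≤ N → ∃[ e ] ∃[ N′ ] (N ≡ p ^ e ℕ.* N′) × ¬ p ℕ∣.∣ N′
prime-power-factor {p} pr = <-rec _ step
  where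
  instance _ = prime⇒nonTrivial pr
  step : ∀ N → (∀ {M} → M ℕ.< N → 1 ℕ.≤ M → ∃[ e ] ∃[ N′ ] (M ≡ p ^ e ℕ.* N′) × ¬ p ℕ∣.∣ N′) →
         1 ℕ.≤ N → ∃[ e ] ∃[ N′ ] (N ≡ p ^ e ℕ.* N′) × ¬ p ℕ∣.∣ N′
  step N rec 1≤N with p ℕ∣.∣? N
  ... | no p∤N = 0 , N , sym (ℕP.+-identityʳ N) , p∤N
  ... | yes (divides q N≡qp) with rec q<N 1≤q
    where
    1≤q : 1 ℕ.≤ q
    1≤q = ℕP.n≢0⇒n>0 λ { refl → ℕP.<⇒≢ 1≤N (sym N≡qp) }
    q<N : q ℕ.< N
    q<N = subst (q ℕ.<_) (sym N≡qp) (ℕP.m<m*n q p {{ℕ.>-nonZero 1≤q}} (ℕ.nonTrivial⇒n>1 p))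
  ... | e , N′ , q≡pᵉN′ , p∤N′ = suc e , N′ , trans N≡qp (trans (cong (ℕ._* p) q≡pᵉN′) (rearrange (p ^ e) N′ p)) , p∤N′
    where
    rearrange : ∀ a b c → a ℕ.* b ℕ.* c ≡ c ℕ.* a ℕ.* b
    rearrange a b c = trans (ℕP.*-comm (a ℕ.* b) c) (sym (ℕP.*-assoc c a b))

∣-lincomb : ∀ {k m n} → k ℤ∣.∣ m → k ℤ∣.∣ n → ∀ s t → k ℤ∣.∣ s ℤ.* m ℤ.+ t ℤ.* n
∣-lincomb k∣m k∣n s t = ℤ∣.∣m∣n⇒∣m+n (ℤ∣.∣n⇒∣m*n s k∣m) (ℤ∣.∣n⇒∣m*n t k∣n)

-- The linear map (zr, zi) ↦ (2 zr + D zi, D zr + (D² - 2K) zi) has determinant D² - 4K = D.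
trace-congruences : ∀ {p} → Prime p → ∀ n {D K} → D ℤ.* D ℤ.- D ≡ + 4 ℤ.* K → ¬ + p ℤ∣.∣ D →
  ∀ {A} → ¬ + p ℤ∣.∣ A → ∀ P Q → ∃[ zr ] ∃[ zi ]
    (+ (p ^ n) ℤ∣.∣ A ℤ.* (+ 2 ℤ.* zr ℤ.+ D ℤ.* zi) ℤ.+ P) ×
    (+ (p ^ n) ℤ∣.∣ A ℤ.* (D ℤ.* zr ℤ.+ (D ℤ.* D ℤ.- + 2 ℤ.* K) ℤ.* zi) ℤ.+ Q)
trace-congruences {p} pr n {D} {K} disc p∤D {A} p∤A P Q with inverse-mod-prime^ pr (D ℤ.* A) p∤DA n
  where
  p∤DA : ¬ + p ℤ∣.∣ D ℤ.* A
  p∤DA p∣DA with euclidᶻ pr D A p∣DA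
  ... | inj₁ p∣D = p∤D p∣D
  ... | inj₂ p∣A = p∤A p∣A
... | l , pⁿ∣lDA-1 = zr , zi , pⁿ∣ P (P-eq A l D K P Q) , pⁿ∣ Q (Q-eq A l D K P Q)
  where
  open Data.Integer using (_+_; _*_; _-_; -_)
  zr = l * (D * Q - (D * D - + 2 * K) * P)
  zi = l * (D * P - + 2 * Q)
  pⁿ∣ : ∀ R {V} → V ≡ A * l * R * (+ 4 * K - (D * D - D)) - R * (l * (D * A) - + 1) → + (p ^ n) ℤ∣.∣ V
  pⁿ∣ R {V} V≡ = subst (+ (p ^ n) ℤ∣.∣_) (sym (trans V≡ (trans (cong (λ t → A * l * R * (+ 4 * K - t) - R * (l * (D * A) - + 1)) disc)
                                                                (cancel A l R K (l * (D * A) - + 1)))))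
                         (ℤ∣.∣n⇒∣m*n (- R) pⁿ∣lDA-1)
    where
    cancel : ∀ A l R K e → A * l * R * (+ 4 * K - + 4 * K) - R * e ≡ (- R) * e
    cancel = ℤ-Solver.solve-∀
  P-eq : ∀ A l D K P Q → A * (+ 2 * (l * (D * Q - (D * D - + 2 * K) * P)) + D * (l * (D * P - + 2 * Q))) + P
                         ≡ A * l * P * (+ 4 * K - (D * D - D)) - P * (l * (D * A) - + 1)
  P-eq = ℤ-Solver.solve-∀
  Q-eq : ∀ A l D K P Q → A * (D * (l * (D * Q - (D * D - + 2 * K) * P)) + (D * D - + 2 * K) * (l * (D * P - + 2 * Q))) + Q
                         ≡ A * l * Q * (+ 4 * K - (D * D - D)) - Q * (l * (D * A) - + 1)
  Q-eq = ℤ-Solver.solve-∀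

residue-of-quotient : ∀ {M N μ} → + M ℤ∣.∣ μ ℤ.* N ℤ.- + 1 → ∀ B b q → B ℤ.* μ ≡ + b ℤ.+ q ℤ.* + M →
                      + M ℤ∣.∣ B ℤ.- N ℤ.* + b
residue-of-quotient {M} {N} {μ} (divides k μN-1≡kM) B b q B*μ≡ = divides (N * q - B * k) (begin
  B - N * + b                       ≡⟨ cong (λ t → B - N * t) (eliminate (+ b) (B * μ) (q * + M) B*μ≡) ⟩
  B - N * (B * μ - q * + M)         ≡⟨ expand B N μ q (+ M) ⟩
  (N * q) * + M - B * (μ * N - + 1) ≡⟨ cong (λ t → (N * q) * + M - B * t) μN-1≡kM ⟩
  (N * q) * + M - B * (k * + M)     ≡⟨ collect N q B k (+ M) ⟩
  (N * q - B * k) * + M             ∎)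
  where
  open ≡-Reasoning
  open Data.Integer using (_+_; _*_; _-_)
  eliminate : ∀ b s t → s ≡ b + t → b ≡ s - t
  eliminate b s t s≡ = trans (cancel b t) (cong (λ u → u - t) (sym s≡))
    where
    cancel : ∀ b t → b ≡ b + t - t
    cancel = ℤ-Solver.solve-∀
  expand : ∀ B N μ q m → B - N * (B * μ - q * m) ≡ (N * q) * m - B * (μ * N - + 1)
  expand = ℤ-Solver.solve-∀
  collect : ∀ N q B k m → (N * q) * m - B * (k * m) ≡ (N * q - B * k) * m
  collect = ℤ-Solver.solve-∀

prime∤residue : ∀ {p M N μ} → Prime p → + p ℤ∣.∣ + M → + M ℤ∣.∣ μ ℤ.* N ℤ.- + 1 → ∀ {B} → ¬ + p ℤ∣.∣ B →
                ∀ b q → B ℤ.* μ ≡ + b ℤ.+ q ℤ.* + M → ¬ p ℕ∣.∣ b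
prime∤residue {p} {M} {N} {μ} pr p∣M M∣μN-1 {B} p∤B b q B*μ≡ p∣b with euclidᶻ pr B μ p∣Bμ
  where
  p∣Bμ : + p ℤ∣.∣ B ℤ.* μ
  p∣Bμ = subst (+ p ℤ∣.∣_) (sym B*μ≡) (ℤ∣.∣m∣n⇒∣m+n {m = + b} {n = q ℤ.* + M} (ℤ∣.∣ᵤ⇒∣ p∣b) (ℤ∣.∣n⇒∣m*n q p∣M))
... | inj₁ p∣B = p∤B p∣B
... | inj₂ p∣μ = ¬prime[1] (subst Prime (ℕ∣.∣1⇒≡1 (ℤ∣.∣⇒∣ᵤ p∣1)) pr)
  where
  p∣1 : + p ℤ∣.∣ + 1
  p∣1 = subst (+ p ℤ∣.∣_) (cancel (μ ℤ.* N)) (ℤ∣.∣m∣n⇒∣m-n (ℤ∣.∣m⇒∣m*n N p∣μ) (ℤ∣.∣-trans p∣M M∣μN-1))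
    where
    cancel : ∀ m → m ℤ.- (m ℤ.- + 1) ≡ + 1
    cancel = ℤ-Solver.solve-∀

-- a ≡ A N′⁻¹ and d ≡ C N′⁻¹ modulo pⁿ; d is shifted by pⁿ so that it is positive.
diagonal-residues : ∀ {p} → Prime p → ∀ n → 1 ℕ.≤ n → ∀ {N′} → ¬ p ℕ∣.∣ N′ → ∀ {A} → ¬ + p ℤ∣.∣ A → ∀ C →
  ∃[ a ] ∃[ d ] (1 ℕ.≤ a) × (1 ℕ.≤ d) × ¬ p ℕ∣.∣ a ×
    (+ (p ^ n) ℤ∣.∣ A ℤ.- + N′ ℤ.* + a) × (+ (p ^ n) ℤ∣.∣ C ℤ.- + N′ ℤ.* + d)
diagonal-residues {p} pr n 1≤n {N′} p∤N′ {A} p∤A C with inverse-mod-prime^ pr (+ N′) (p∤N′ ∘ ℤ∣.∣⇒∣ᵤ) n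
... | μ , pⁿ∣μN′-1 =
  a , r ℕ.+ p ^ n , 1≤a , ℕP.≤-trans (ℕP.m^n>0 p n) (ℕP.m≤n+m (p ^ n) r) , p∤a ,
  residue-of-quotient {p ^ n} {+ N′} {μ} pⁿ∣μN′-1 A a (A * μ ℤ./ℕ p ^ n) (ℤDM.a≡a%ℕn+[a/ℕn]*n (A * μ) (p ^ n)) ,
  residue-of-quotient {p ^ n} {+ N′} {μ} pⁿ∣μN′-1 C (r ℕ.+ p ^ n) (C * μ ℤ./ℕ p ^ n - + 1) C*μ≡
  where
  open Data.Integer using (_+_; _*_; _-_)
  instance
    p≢0 = prime⇒nonZero pr
    pⁿ≢0 = ℕP.m^n≢0 p n
  a = A * μ ℤ.%ℕ p ^ n
  r = C * μ ℤ.%ℕ p ^ n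
  C*μ≡ : C * μ ≡ + (r ℕ.+ p ^ n) + (C * μ ℤ./ℕ p ^ n - + 1) * + (p ^ n)
  C*μ≡ = trans (ℤDM.a≡a%ℕn+[a/ℕn]*n (C * μ) (p ^ n))
    (trans (shift (+ r) (C * μ ℤ./ℕ p ^ n) (+ (p ^ n))) (cong (λ t → t + (C * μ ℤ./ℕ p ^ n - + 1) * + (p ^ n)) (sym (ℤP.pos-+ r (p ^ n)))))
    where
    shift : ∀ r q m → r + q * m ≡ (r + m) + (q - + 1) * m
    shift = ℤ-Solver.solve-∀
  p∣pⁿ : + p ℤ∣.∣ + (p ^ n)
  p∣pⁿ = ℤ∣.∣ᵤ⇒∣ (m∣m^n p 1≤n)
  p∤a : ¬ p ℕ∣.∣ a
  p∤a = prime∤residue {p} {p ^ n} {+ N′} {μ} pr p∣pⁿ pⁿ∣μN′-1 p∤A a (A * μ ℤ./ℕ p ^ n) (ℤDM.a≡a%ℕn+[a/ℕn]*n (A * μ) (p ^ n))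
  1≤a : 1 ℕ.≤ a
  1≤a = ℕP.n≢0⇒n>0 λ a≡0 → p∤a (subst (p ℕ∣.∣_) (sym a≡0) (p ℕ∣.∣0))

diagonal-clearing : ∀ {p} → Prime p → ∀ n → 1 ℕ.≤ n → ∀ e {N′} → ¬ p ℕ∣.∣ N′ → ∀ {A₀ C₀} →
  + (p ^ e) ℤ∣.∣ A₀ → ¬ + (p ^ suc e) ℤ∣.∣ A₀ → + (p ^ e) ℤ∣.∣ C₀ →
  ∃[ a ] ∃[ d ] (1 ℕ.≤ a) × (1 ℕ.≤ d) × ¬ p ℕ∣.∣ a ×
    (+ (p ^ n) ℤ∣.∣ A₀ ℤ.- + (p ^ e ℕ.* N′ ℕ.* a)) × (+ (p ^ n) ℤ∣.∣ C₀ ℤ.- + (p ^ e ℕ.* N′ ℕ.* d))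
diagonal-clearing {p} pr n 1≤n e {N′} p∤N′ (divides A refl) pᵉ⁺¹∤A₀ (divides C refl) =
  scale (diagonal-residues pr n 1≤n p∤N′ p∤A C)
  where
  open Data.Integer using (_+_; _*_; _-_)
  p∤A : ¬ + p ℤ∣.∣ A
  p∤A (divides q refl) = pᵉ⁺¹∤A₀ (divides q (trans (ℤP.*-assoc q (+ p) (+ (p ^ e))) (cong (q *_) (sym (ℤP.pos-* p (p ^ e))))))
  pull : ∀ B b → B * + (p ^ e) - + (p ^ e ℕ.* N′ ℕ.* b) ≡ (B - + N′ * + b) * + (p ^ e)
  pull B b = trans (cong (λ t → B * + (p ^ e) - t) (trans (ℤP.pos-* (p ^ e ℕ.* N′) b) (cong (_* + b) (ℤP.pos-* (p ^ e) N′))))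
                   (regroup B (+ b) (+ N′) (+ (p ^ e)))
    where
    regroup : ∀ B b N pᵉ → B * pᵉ - pᵉ * N * b ≡ (B - N * b) * pᵉ
    regroup = ℤ-Solver.solve-∀
  scale : ∃[ a ] ∃[ d ] (1 ℕ.≤ a) × (1 ℕ.≤ d) × ¬ p ℕ∣.∣ a × (+ (p ^ n) ℤ∣.∣ A - + N′ * + a) × (+ (p ^ n) ℤ∣.∣ C - + N′ * + d) →
          ∃[ a ] ∃[ d ] (1 ℕ.≤ a) × (1 ℕ.≤ d) × ¬ p ℕ∣.∣ a ×
            (+ (p ^ n) ℤ∣.∣ A * + (p ^ e) - + (p ^ e ℕ.* N′ ℕ.* a)) × (+ (p ^ n) ℤ∣.∣ C * + (p ^ e) - + (p ^ e ℕ.* N′ ℕ.* d))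
  scale (a , d , 1≤a , 1≤d , p∤a , kA , kC) =
    a , d , 1≤a , 1≤d , p∤a ,
    subst (+ (p ^ n) ℤ∣.∣_) (sym (pull A a)) (ℤ∣.∣m⇒∣m*n (+ (p ^ e)) kA) ,
    subst (+ (p ^ n) ℤ∣.∣_) (sym (pull C d)) (ℤ∣.∣m⇒∣m*n (+ (p ^ e)) kC)

discriminant-quarter : ∀ {D} → ImagQuadDisc D → ∃[ K ] (Field.Nω D ≡ fromℤ K) × (D ℤ.* D ℤ.- D ≡ + 4 ℤ.* K)
discriminant-quarter {D} (_ , inj₁ (4∣D-1 , _)) with ℤ∣.∣ᵤ⇒∣ 4∣D-1
... | divides j D-1≡j*4 = K , trans (cong (ℚ._/ 4) D²-D≡4K) ([4z]/4≡fromℤ[z] K) , D²-D≡4K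
  where
  open Data.Integer using (_+_; _*_; _-_)
  K = j * D
  D²-D≡4K : D * D - D ≡ + 4 * K
  D²-D≡4K = trans (factor D) (trans (cong (λ t → t * D) {D - + 1} D-1≡j*4) (regroup j D))
    where
    factor : ∀ D → D * D - D ≡ (D - + 1) * D
    factor = ℤ-Solver.solve-∀
    regroup : ∀ j D → j * + 4 * D ≡ + 4 * (j * D)
    regroup = ℤ-Solver.solve-∀
discriminant-quarter {D} (_ , inj₂ (m , D≡4m , _)) = K , trans (cong (ℚ._/ 4) D²-D≡4K) ([4z]/4≡fromℤ[z] K) , D²-D≡4K
  where
  open Data.Integer using (_+_; _*_; _-_)
  K = m * (D - + 1)
  D²-D≡4K : D * D - D ≡ + 4 * K
  D²-D≡4K = trans (factor D) (trans (cong (λ t → t * (D - + 1)) D≡4m) (regroup m D))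
    where
    factor : ∀ D → D * D - D ≡ D * (D - + 1)
    factor = ℤ-Solver.solve-∀
    regroup : ∀ m D → + 4 * m * (D - + 1) ≡ + 4 * (m * (D - + 1))
    regroup = ℤ-Solver.solve-∀

-- Distinct roots of X² - D X + K modulo p force p ∤ D² - 4K = D.
splits⇒∤D : ∀ {D K p} → Field.Nω D ≡ fromℤ K → D ℤ.* D ℤ.- D ≡ + 4 ℤ.* K → Field.Splits D p → ¬ + p ℤ∣.∣ D
splits⇒∤D {D} {K} {p} Nω≡K disc (pr , r , s , r≢s , (k , r-root) , (k′ , s-root)) p∣D = r≢s (ℤ∣.∣⇒∣ᵤ p∣r-s)
  where
  open Data.Integer using (_+_; _*_; _-_)
  f : ℤ → ℤ
  f x = x * x - D * x + K
  root : ∀ {x k} → fromℤ (x * x - D * x) ℚ.+ Field.Nω D ≡ fromℤ (+ p * k) → + p ℤ∣.∣ f x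
  root {x} {k} eq = divides k (trans (fromℤ-injective {x * x - D * x + K} {+ p * k} (trans (fromℤ-homo-+ (x * x - D * x) K)
                                        (trans (cong (fromℤ (x * x - D * x) ℚ.+_) (sym Nω≡K)) eq)))
                                     (ℤP.*-comm (+ p) k))
  t = r + s - D
  p∣[r-s]t : + p ℤ∣.∣ (r - s) * t
  p∣[r-s]t = subst (+ p ℤ∣.∣_) (sym (difference r s D K)) (ℤ∣.∣m∣n⇒∣m-n (root {r} {k} r-root) (root {s} {k′} s-root))
    where
    difference : ∀ r s D K → (r - s) * (r + s - D) ≡ (r * r - D * r + K) - (s * s - D * s + K)
    difference = ℤ-Solver.solve-∀
  p∣[r-s]² : + p ℤ∣.∣ t → + p ℤ∣.∣ (r - s) * (r - s)
  p∣[r-s]² p∣t = subst (+ p ℤ∣.∣_) (sym (square r s D K))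
    (ℤ∣.∣m∣n⇒∣m+n (ℤ∣.∣m∣n⇒∣m+n (ℤ∣.∣m∣n⇒∣m+n (ℤ∣.∣m⇒∣m*n (t + + 2 * D - + 4 * r) p∣t) (ℤ∣.∣n⇒∣m*n (+ 4) (root {r} {k} r-root))) p∣0)
                  p∣D)
    where
    square : ∀ r s D K → (r - s) * (r - s) ≡ (r + s - D) * ((r + s - D) + + 2 * D - + 4 * r) + + 4 * (r * r - D * r + K) + ((D * D - D) - + 4 * K) + D
    square = ℤ-Solver.solve-∀
    p∣0 : + p ℤ∣.∣ (D * D - D) - + 4 * K
    p∣0 = divides (+ 0) (trans (cong (_- + 4 * K) disc) (ℤP.+-inverseʳ (+ 4 * K)))
  p∣r-s : + p ℤ∣.∣ r - s
  p∣r-s = [ id , (λ p∣t → [ id , id ]′ (euclidᶻ pr (r - s) (r - s) (p∣[r-s]² p∣t))) ]′ (euclidᶻ pr (r - s) t p∣[r-s]t)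

-- Arithmetic of F and O_F

-- The coordinates (a, c, Tr b, Tr (ω b)) of h = (a b; b̄ c) ∈ T, see _HasCoords_.
record Coords : Set where
  constructor coords
  field a c P Q : ℤ

infix 4 _∣ᶜ_
_∣ᶜ_ : ℤ → Coords → Set
k ∣ᶜ coords a c P Q = k ℤ∣.∣ a × k ℤ∣.∣ c × k ℤ∣.∣ P × k ℤ∣.∣ Q

module FieldProperties (D K : ℤ) (Nω≡K : Field.Nω D ≡ fromℤ K) where
  open Field D

  -- The laws of F hold whatever ω² = D ω - Nω is, so D and Nω are generalised to variables δ and ν for the solver.
  F-ext : ∀ {x y : F} → re x ≡ re y → im x ≡ im y → x ≡ y
  F-ext {_ + _ ω} {_ + _ ω} refl refl = refl

  ⊕-assoc : ∀ x y z → (x ⊕ y) ⊕ z ≡ x ⊕ (y ⊕ z)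
  ⊕-assoc (a + b ω) (c + d ω) (e + f ω) = F-ext (ℚP.+-assoc a c e) (ℚP.+-assoc b d f)

  ⊕-comm : ∀ x y → x ⊕ y ≡ y ⊕ x
  ⊕-comm (a + b ω) (c + d ω) = F-ext (ℚP.+-comm a c) (ℚP.+-comm b d)

  ⊕-identityˡ : ∀ x → 0F ⊕ x ≡ x
  ⊕-identityˡ (a + b ω) = F-ext (ℚP.+-identityˡ a) (ℚP.+-identityˡ b)

  ⊕-identityʳ : ∀ x → x ⊕ 0F ≡ x
  ⊕-identityʳ (a + b ω) = F-ext (ℚP.+-identityʳ a) (ℚP.+-identityʳ b)

  ⊖-inverseˡ : ∀ x → (⊖ x) ⊕ x ≡ 0F
  ⊖-inverseˡ (a + b ω) = F-ext (ℚP.+-inverseˡ a) (ℚP.+-inverseˡ b)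

  ⊖-inverseʳ : ∀ x → x ⊕ (⊖ x) ≡ 0F
  ⊖-inverseʳ (a + b ω) = F-ext (ℚP.+-inverseʳ a) (ℚP.+-inverseʳ b)

  ⊛-assoc : ∀ x y z → (x ⊛ y) ⊛ z ≡ x ⊛ (y ⊛ z)
  ⊛-assoc (a + b ω) (c + d ω) (e + f ω) = F-ext (re-eq a b c d e f Dq Nω) (im-eq a b c d e f Dq Nω)
    where
    open Data.Rational using (_+_; _*_; _-_)
    re-eq : ∀ a b c d e f δ ν →
      (a * c - b * d * ν) * e - (a * d + b * c + b * d * δ) * f * ν
        ≡ a * (c * e - d * f * ν) - b * (c * f + d * e + d * f * δ) * ν
    re-eq = Solver.solve-∀ ℚ-ring
    im-eq : ∀ a b c d e f δ ν →
      (a * c - b * d * ν) * f + (a * d + b * c + b * d * δ) * e + (a * d + b * c + b * d * δ) * f * δ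
        ≡ a * (c * f + d * e + d * f * δ) + b * (c * e - d * f * ν) + b * (c * f + d * e + d * f * δ) * δ
    im-eq = Solver.solve-∀ ℚ-ring

  ⊛-comm : ∀ x y → x ⊛ y ≡ y ⊛ x
  ⊛-comm (a + b ω) (c + d ω) = F-ext (re-eq a b c d Nω) (im-eq a b c d Dq)
    where
    open Data.Rational using (_+_; _*_; _-_)
    re-eq : ∀ a b c d ν → a * c - b * d * ν ≡ c * a - d * b * ν
    re-eq = Solver.solve-∀ ℚ-ring
    im-eq : ∀ a b c d δ → a * d + b * c + b * d * δ ≡ c * b + d * a + d * b * δ
    im-eq = Solver.solve-∀ ℚ-ring

  ⊛-identityˡ : ∀ x → 1F ⊛ x ≡ x
  ⊛-identityˡ (a + b ω) = F-ext (re-eq a b Nω) (im-eq a b Dq)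
    where
    open Data.Rational using (_+_; _*_; _-_)
    re-eq : ∀ a b ν → 1ℚ * a - 0ℚ * b * ν ≡ a
    re-eq = Solver.solve-∀ ℚ-ring
    im-eq : ∀ a b δ → 1ℚ * b + 0ℚ * a + 0ℚ * b * δ ≡ b
    im-eq = Solver.solve-∀ ℚ-ring

  ⊛-distribˡ-⊕ : ∀ x y z → x ⊛ (y ⊕ z) ≡ (x ⊛ y) ⊕ (x ⊛ z)
  ⊛-distribˡ-⊕ (a + b ω) (c + d ω) (e + f ω) = F-ext (re-eq a b c d e f Nω) (im-eq a b c d e f Dq)
    where
    open Data.Rational using (_+_; _*_; _-_)
    re-eq : ∀ a b c d e f ν → a * (c + e) - b * (d + f) * ν ≡ (a * c - b * d * ν) + (a * e - b * f * ν)
    re-eq = Solver.solve-∀ ℚ-ring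
    im-eq : ∀ a b c d e f δ →
      a * (d + f) + b * (c + e) + b * (d + f) * δ ≡ (a * d + b * c + b * d * δ) + (a * f + b * e + b * f * δ)
    im-eq = Solver.solve-∀ ℚ-ring

  ofℚ-homo-+ : ∀ q r → ofℚ (q ℚ.+ r) ≡ ofℚ q ⊕ ofℚ r
  ofℚ-homo-+ q r = F-ext refl (sym (ℚP.+-identityʳ 0ℚ))

  ofℚ-homo-* : ∀ q r → ofℚ (q ℚ.* r) ≡ ofℚ q ⊛ ofℚ r
  ofℚ-homo-* q r = F-ext (re-eq q r Nω) (im-eq q r Dq)
    where
    open Data.Rational using (_+_; _*_; _-_)
    re-eq : ∀ q r ν → q * r ≡ q * r - 0ℚ * 0ℚ * ν
    re-eq = Solver.solve-∀ ℚ-ring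
    im-eq : ∀ q r δ → 0ℚ ≡ q * 0ℚ + 0ℚ * r + 0ℚ * 0ℚ * δ
    im-eq = Solver.solve-∀ ℚ-ring

  ofℚ-homo‿- : ∀ q → ofℚ (ℚ.- q) ≡ ⊖ ofℚ q
  ofℚ-homo‿- q = F-ext refl refl

  ιℤ : ℤ → F
  ιℤ m = ofℚ (fromℤ m)

  conj-⊕ : ∀ x y → conj (x ⊕ y) ≡ conj x ⊕ conj y
  conj-⊕ (a + b ω) (c + d ω) = F-ext (re-eq a b c d Dq) (ℚP.neg-distrib-+ b d)
    where
    open Data.Rational using (_+_; _*_)
    re-eq : ∀ a b c d δ → (a + c) + (b + d) * δ ≡ (a + b * δ) + (c + d * δ)
    re-eq = Solver.solve-∀ ℚ-ring

  conj-⊛ : ∀ x y → conj (x ⊛ y) ≡ conj x ⊛ conj y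
  conj-⊛ (a + b ω) (c + d ω) = F-ext (re-eq a b c d Dq Nω) (im-eq a b c d Dq Nω)
    where
    open Data.Rational using (_+_; _*_; _-_; -_)
    re-eq : ∀ a b c d δ ν →
      (a * c - b * d * ν) + (a * d + b * c + b * d * δ) * δ ≡ (a + b * δ) * (c + d * δ) - (- b) * (- d) * ν
    re-eq = Solver.solve-∀ ℚ-ring
    im-eq : ∀ a b c d δ ν →
      - (a * d + b * c + b * d * δ) ≡ (a + b * δ) * (- d) + (- b) * (c + d * δ) + (- b) * (- d) * δ
    im-eq = Solver.solve-∀ ℚ-ring

  conj-involutive : ∀ x → conj (conj x) ≡ x
  conj-involutive (a + b ω) = F-ext (re-eq a b Dq) (im-eq b)
    where
    open Data.Rational using (_+_; _*_; -_)
    re-eq : ∀ a b δ → (a + b * δ) + (- b) * δ ≡ a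
    re-eq = Solver.solve-∀ ℚ-ring
    im-eq : ∀ b → - (- b) ≡ b
    im-eq = Solver.solve-∀ ℚ-ring

  conj-ofℚ : ∀ q → conj (ofℚ q) ≡ ofℚ q
  conj-ofℚ q = F-ext (trans (cong (q ℚ.+_) (ℚP.*-zeroˡ Dq)) (ℚP.+-identityʳ q)) refl

  Tr : F → ℚ
  Tr x = re (x ⊕ conj x)

  x⊕conj[x]≡ofℚ[Tr[x]] : ∀ x → x ⊕ conj x ≡ ofℚ (Tr x)
  x⊕conj[x]≡ofℚ[Tr[x]] (a + b ω) = F-ext refl (ℚP.+-inverseʳ b)

  Tr-⊕ : ∀ x y → Tr (x ⊕ y) ≡ Tr x ℚ.+ Tr y
  Tr-⊕ x y = cong re (begin
    (x ⊕ y) ⊕ conj (x ⊕ y)        ≡⟨ cong ((x ⊕ y) ⊕_) (conj-⊕ x y) ⟩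
    (x ⊕ y) ⊕ (conj x ⊕ conj y)   ≡⟨ ⊕-interchange x y (conj x) (conj y) ⟩
    (x ⊕ conj x) ⊕ (y ⊕ conj y)   ∎)
    where
    open ≡-Reasoning
    ⊕-interchange : ∀ x y z w → (x ⊕ y) ⊕ (z ⊕ w) ≡ (x ⊕ z) ⊕ (y ⊕ w)
    ⊕-interchange (a + b ω) (c + d ω) (e + f ω) (g + h ω) = F-ext (eq a c e g) (eq b d f h)
      where
      open Data.Rational using (_+_)
      eq : ∀ a b c d → (a + b) + (c + d) ≡ (a + c) + (b + d)
      eq = Solver.solve-∀ ℚ-ring

  Tr-conj : ∀ x → Tr (conj x) ≡ Tr x
  Tr-conj x = cong re (trans (cong (conj x ⊕_) (conj-involutive x)) (⊕-comm (conj x) x))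

  Tr-ofℚ⊛ : ∀ q x → Tr (ofℚ q ⊛ x) ≡ q ℚ.* Tr x
  Tr-ofℚ⊛ q (a + b ω) = eq q a b Dq Nω
    where
    open Data.Rational using (_+_; _*_; _-_; -_)
    eq : ∀ q a b δ ν → (q * a - 0ℚ * b * ν) + ((q * a - 0ℚ * b * ν) + (q * b + 0ℚ * a + 0ℚ * b * δ) * δ)
                         ≡ q * (a + (a + b * δ))
    eq = Solver.solve-∀ ℚ-ring

  infixl 6 _+ₒ_
  infixl 7 _·ₒ_
  _+ₒ_ _·ₒ_ : OF → OF → OF
  (x + y ω') +ₒ (x′ + y′ ω') = (x ℤ.+ x′) + (y ℤ.+ y′) ω'
  (x + y ω') ·ₒ (x′ + y′ ω') = (x ℤ.* x′ ℤ.- y ℤ.* y′ ℤ.* K) + (x ℤ.* y′ ℤ.+ y ℤ.* x′ ℤ.+ y ℤ.* y′ ℤ.* D) ω'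

  conjₒ : OF → OF
  conjₒ (x + y ω') = (x ℤ.+ y ℤ.* D) + (ℤ.- y) ω'

  0ₒ 1ₒ ωₒ : OF
  0ₒ = (+ 0) + (+ 0) ω'
  1ₒ = (+ 1) + (+ 0) ω'
  ωₒ = (+ 0) + (+ 1) ω'

  ι-+ₒ : ∀ α β → ι (α +ₒ β) ≡ ι α ⊕ ι β
  ι-+ₒ (x + y ω') (x′ + y′ ω') = F-ext (fromℤ-homo-+ x x′) (fromℤ-homo-+ y y′)

  ι-·ₒ : ∀ α β → ι (α ·ₒ β) ≡ ι α ⊛ ι β
  ι-·ₒ (x + y ω') (x′ + y′ ω') = F-ext
    (trans (fromℤ-homo-- (x ℤ.* x′) (y ℤ.* y′ ℤ.* K))
      (cong₂ ℚ._-_ (fromℤ-homo-* x x′) (trans (fromℤ-homo-* (y ℤ.* y′) K) (cong₂ ℚ._*_ (fromℤ-homo-* y y′) (sym Nω≡K)))))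
    (trans (fromℤ-homo-+ (x ℤ.* y′ ℤ.+ y ℤ.* x′) (y ℤ.* y′ ℤ.* D))
      (cong₂ ℚ._+_ (trans (fromℤ-homo-+ (x ℤ.* y′) (y ℤ.* x′)) (cong₂ ℚ._+_ (fromℤ-homo-* x y′) (fromℤ-homo-* y x′)))
                   (trans (fromℤ-homo-* (y ℤ.* y′) D) (cong (ℚ._* Dq) (fromℤ-homo-* y y′)))))

  ι-conjₒ : ∀ α → ι (conjₒ α) ≡ conj (ι α)
  ι-conjₒ (x + y ω') = F-ext
    (trans (fromℤ-homo-+ x (y ℤ.* D)) (cong (fromℤ x ℚ.+_) (fromℤ-homo-* y D)))
    (fromℤ-homo‿- y)

  normₒ trₒ : OF → ℤ
  normₒ α = reZ (conjₒ α ·ₒ α)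
  trₒ α = reZ (α +ₒ conjₒ α)

  pairₒ : OF → ℤ → ℤ → ℤ
  pairₒ (u + v ω') P Q = u ℤ.* P ℤ.+ v ℤ.* Q

  conjₒ[α]·ₒα-real : ∀ α → imZ (conjₒ α ·ₒ α) ≡ + 0
  conjₒ[α]·ₒα-real (x + y ω') = eq x y D
    where
    open Data.Integer using (_+_; _*_; _-_; -_)
    eq : ∀ x y D → (x + y * D) * y + (- y) * x + (- y) * y * D ≡ + 0
    eq = ℤ-Solver.solve-∀

  conjₒ-involutive : ∀ α → conjₒ (conjₒ α) ≡ α
  conjₒ-involutive (x + y ω') = cong₂ _+_ω' (re-eq x y D) (ℤP.neg-involutive y)
    where
    open Data.Integer using (_+_; _*_; -_)
    re-eq : ∀ x y D → x + y * D + (- y) * D ≡ x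
    re-eq = ℤ-Solver.solve-∀

  -- For v, w ∈ O_F² and h with coordinates x, quad x v and bil t x v w are the integers
  -- ⟨ v ∣ h ∣ v ⟩ and Tr (t ⟨ v ∣ h ∣ w ⟩), see ⟨⟩-diag-integral and ⟨⟩-pairing-integral.
  quad : Coords → OF × OF → ℤ
  quad x (α , γ) = a ℤ.* normₒ α ℤ.+ c ℤ.* normₒ γ ℤ.+ pairₒ (conjₒ α ·ₒ γ) P Q
    where open Coords x

  bil : OF → Coords → OF × OF → OF × OF → ℤ
  bil t x (α , γ) (β , δ) =
    a ℤ.* trₒ (t ·ₒ (conjₒ α ·ₒ β)) ℤ.+ c ℤ.* trₒ (t ·ₒ (conjₒ γ ·ₒ δ))
      ℤ.+ (pairₒ (t ·ₒ (conjₒ α ·ₒ δ)) P Q ℤ.+ pairₒ (conjₒ t ·ₒ (conjₒ β ·ₒ γ)) P Q)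
    where open Coords x

  trₒ[1ₒ·ₒz] : ∀ zr zi → trₒ (1ₒ ·ₒ (zr + zi ω')) ≡ + 2 ℤ.* zr ℤ.+ D ℤ.* zi
  trₒ[1ₒ·ₒz] zr zi = eq zr zi D K
    where
    open Data.Integer using (_+_; _*_; _-_)
    eq : ∀ zr zi D K → let w₁ = + 1 * zr - + 0 * zi * K ; w₂ = + 1 * zi + + 0 * zr + + 0 * zi * D
                       in w₁ + (w₁ + w₂ * D) ≡ + 2 * zr + D * zi
    eq = ℤ-Solver.solve-∀

  trₒ[ωₒ·ₒz] : ∀ zr zi → trₒ (ωₒ ·ₒ (zr + zi ω')) ≡ D ℤ.* zr ℤ.+ (D ℤ.* D ℤ.- + 2 ℤ.* K) ℤ.* zi
  trₒ[ωₒ·ₒz] zr zi = eq zr zi D K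
    where
    open Data.Integer using (_+_; _*_; _-_)
    eq : ∀ zr zi D K → let w₁ = + 0 * zr - + 1 * zi * K ; w₂ = + 0 * zi + + 1 * zr + + 1 * zi * D
                       in w₁ + (w₁ + w₂ * D) ≡ D * zr + (D * D - + 2 * K) * zi
    eq = ℤ-Solver.solve-∀

  quad[1,0] : ∀ x → quad x (1ₒ , 0ₒ) ≡ Coords.a x
  quad[1,0] (coords a c P Q) = eq a c P Q
    where
    open Data.Integer using (_+_; _*_)
    eq : ∀ a c P Q → a * (+ 1) + c * (+ 0) + (+ 0 * P + + 0 * Q) ≡ a
    eq = ℤ-Solver.solve-∀

  quad[0,1] : ∀ x → quad x (0ₒ , 1ₒ) ≡ Coords.c x
  quad[0,1] (coords a c P Q) = eq a c P Q
    where
    open Data.Integer using (_+_; _*_)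
    eq : ∀ a c P Q → a * (+ 0) + c * (+ 1) + (+ 0 * P + + 0 * Q) ≡ c
    eq = ℤ-Solver.solve-∀

  quad[1,1] : ∀ x → quad x (1ₒ , 1ₒ) ≡ Coords.a x ℤ.+ Coords.c x ℤ.+ Coords.P x
  quad[1,1] (coords a c P Q) = eq a c P Q
    where
    open Data.Integer using (_+_; _*_)
    eq : ∀ a c P Q → a * (+ 1) + c * (+ 1) + (+ 1 * P + + 0 * Q) ≡ a + c + P
    eq = ℤ-Solver.solve-∀

  quad[1,ω] : ∀ x → quad x (1ₒ , ωₒ) ≡ Coords.a x ℤ.+ Coords.c x ℤ.* K ℤ.+ Coords.Q x
  quad[1,ω] (coords a c P Q) = eq a c P Q D K
    where
    open Data.Integer using (_+_; _*_; _-_; -_)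
    eq : ∀ a c P Q D K → a * (+ 1) + c * ((+ 0 + + 1 * D) * (+ 0) - (- + 1) * (+ 1) * K) + (+ 0 * P + + 1 * Q) ≡ a + c * K + Q
    eq = ℤ-Solver.solve-∀

  ι-decompose : ∀ u v → ι (u + v ω') ≡ (ιℤ u ⊛ ι 1ₒ) ⊕ (ιℤ v ⊛ ι ωₒ)
  ι-decompose u v = F-ext (re-eq (fromℤ u) (fromℤ v) Nω) (im-eq (fromℤ u) (fromℤ v) Dq)
    where
    open Data.Rational using (_+_; _*_; _-_)
    re-eq : ∀ U V ν → U ≡ (U * 1ℚ - 0ℚ * 0ℚ * ν) + (V * 0ℚ - 0ℚ * 1ℚ * ν)
    re-eq = Solver.solve-∀ ℚ-ring
    im-eq : ∀ U V δ → V ≡ (U * 0ℚ + 0ℚ * 1ℚ + 0ℚ * 0ℚ * δ) + (V * 1ℚ + 0ℚ * 0ℚ + 0ℚ * 1ℚ * δ)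
    im-eq = Solver.solve-∀ ℚ-ring

  F-commutativeRing : CommutativeRing _ _
  F-commutativeRing = record
    { Carrier = F ; _≈_ = _≡_ ; _+_ = _⊕_ ; _*_ = _⊛_ ; -_ = ⊖_ ; 0# = 0F ; 1# = 1F
    ; isCommutativeRing = record
      { isRing = record
        { +-isAbelianGroup = record
          { isGroup = record
            { isMonoid = record
              { isSemigroup = record
                { isMagma = record { isEquivalence = isEquivalence ; ∙-cong = cong₂ _⊕_ }
                ; assoc = ⊕-assoc }
              ; identity = ⊕-identityˡ , ⊕-identityʳ }
            ; inverse = ⊖-inverseˡ , ⊖-inverseʳ
            ; ⁻¹-cong = cong ⊖_ }
          ; comm = ⊕-comm }
        ; *-cong = cong₂ _⊛_
        ; *-assoc = ⊛-assoc
        ; *-identity = ⊛-identityˡ , λ x → trans (⊛-comm x 1F) (⊛-identityˡ x)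
        ; distrib = ⊛-distribˡ-⊕ , comm∧distrˡ⇒distrʳ ⊛-comm ⊛-distribˡ-⊕ }
      ; *-comm = ⊛-comm } }

  infixl 6 _+_ _-_
  infixl 7 _*_
  _+_ _-_ _*_ : F → F → F
  _+_ = _⊕_
  _*_ = _⊛_
  x - y = x ⊕ (⊖ y)

  ιℤ-homo-+ : ∀ m n → ιℤ (m ℤ.+ n) ≡ ιℤ m + ιℤ n
  ιℤ-homo-+ m n = trans (cong ofℚ (fromℤ-homo-+ m n)) (ofℚ-homo-+ (fromℤ m) (fromℤ n))

  ιℤ-homo-* : ∀ m n → ιℤ (m ℤ.* n) ≡ ιℤ m * ιℤ n
  ιℤ-homo-* m n = trans (cong ofℚ (fromℤ-homo-* m n)) (ofℚ-homo-* (fromℤ m) (fromℤ n))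

  -- Tactic.RingSolver cannot work in F: its coefficients would live in F, where products of
  -- constants involve the abstract Nω and do not compute. Hence the ℤ-coefficient solver.
  ℤ⟶F : ℤ.+-*-rawRing Coefficient-ACR.-Raw-AlmostCommutative⟶ Coefficient-ACR.fromCommutativeRing F-commutativeRing
  ℤ⟶F = record
    { ⟦_⟧ = ιℤ
    ; +-homo = ιℤ-homo-+
    ; *-homo = ιℤ-homo-*
    ; -‿homo = λ m → trans (cong ofℚ (fromℤ-homo‿- m)) (ofℚ-homo‿- (fromℤ m))
    ; 0-homo = refl
    ; 1-homo = refl }

  open import Algebra.Solver.Ring ℤ.+-*-rawRing (Coefficient-ACR.fromCommutativeRing F-commutativeRing) ℤ⟶F
    (λ m n → Maybe.map (cong ιℤ) (dec⇒weaklyDec ℤ._≟_ m n))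
    using (solve; _:+_; _:*_; _:-_; :-_; _:=_; con) public

  -- Hermitian forms

  infixl 7 _∙_
  _∙_ : F × F → F × F → F
  (r , s) ∙ (β , δ) = r * β + s * δ

  ∙-linearʳ : ∀ u z β δ β′ δ′ → u ∙ (z * β + β′ , z * δ + δ′) ≡ z * (u ∙ (β , δ)) + u ∙ (β′ , δ′)
  ∙-linearʳ (r , s) z β δ β′ δ′ =
    solve 7 (λ r s z β δ β′ δ′ → r :* (z :* β :+ β′) :+ s :* (z :* δ :+ δ′) := z :* (r :* β :+ s :* δ) :+ (r :* β′ :+ s :* δ′))
      refl r s z β δ β′ δ′

  infixl 7 _ᴴ·_
  _ᴴ·_ : F × F → M2 F → F × F
  (α , γ) ᴴ· X = (conj α * e11 X + conj γ * e21 X , conj α * e12 X + conj γ * e22 X)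

  -- ⟨ v ∣ X ∣ w ⟩ = v* X w; by definition the entries of u* X u are ⟨ uᵢ ∣ X ∣ uⱼ ⟩ for the columns uᵢ of u.
  infix 4 ⟨_∣_∣_⟩
  ⟨_∣_∣_⟩ : F × F → M2 F → F × F → F
  ⟨ v ∣ X ∣ w ⟩ = v ᴴ· X ∙ w

  conj[conj[β]*γ*b] : ∀ β γ b → conj (conj β * γ * b) ≡ conj γ * β * conj b
  conj[conj[β]*γ*b] β γ b = begin
    conj (conj β * γ * b)               ≡⟨ conj-⊛ (conj β * γ) b ⟩
    conj (conj β * γ) * conj b          ≡⟨ cong (λ t → t * conj b) (conj-⊛ (conj β) γ) ⟩
    conj (conj β) * conj γ * conj b     ≡⟨ cong (λ t → t * conj γ * conj b) (conj-involutive β) ⟩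
    β * conj γ * conj b                 ≡⟨ cong (λ t → t * conj b) (⊛-comm β (conj γ)) ⟩
    conj γ * β * conj b                 ∎
    where open ≡-Reasoning

  ⟨⟩-expand : ∀ a b c α γ β δ → ⟨ (α , γ) ∣ toM (herm a b c) ∣ (β , δ) ⟩
              ≡ ofℚ a * (conj α * β) + ofℚ c * (conj γ * δ) + (conj α * δ * b + conj (conj β * γ * b))
  ⟨⟩-expand a b c α γ β δ = begin
    (conj α * ofℚ a + conj γ * conj b) * β + (conj α * b + conj γ * ofℚ c) * δ
      ≡⟨ solve 8 (λ ᾱ γ̄ a b b̄ c β δ → (ᾱ :* a :+ γ̄ :* b̄) :* β :+ (ᾱ :* b :+ γ̄ :* c) :* δ
                                      := a :* (ᾱ :* β) :+ c :* (γ̄ :* δ) :+ (ᾱ :* δ :* b :+ γ̄ :* β :* b̄))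
           refl (conj α) (conj γ) (ofℚ a) b (conj b) (ofℚ c) β δ ⟩
    ofℚ a * (conj α * β) + ofℚ c * (conj γ * δ) + (conj α * δ * b + conj γ * β * conj b)
      ≡⟨ cong (λ t → ofℚ a * (conj α * β) + ofℚ c * (conj γ * δ) + (conj α * δ * b + t)) (conj[conj[β]*γ*b] β γ b) ⟨
    ofℚ a * (conj α * β) + ofℚ c * (conj γ * δ) + (conj α * δ * b + conj (conj β * γ * b)) ∎
    where open ≡-Reasoning

  conj[q*conj[α]*β] : ∀ q α β → conj (ofℚ q * (conj α * β)) ≡ ofℚ q * (conj β * α)
  conj[q*conj[α]*β] q α β = begin
    conj (ofℚ q * (conj α * β))              ≡⟨ conj-⊛ (ofℚ q) (conj α * β) ⟩
    conj (ofℚ q) * conj (conj α * β)         ≡⟨ cong₂ _*_ (conj-ofℚ q) (conj-⊛ (conj α) β) ⟩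
    ofℚ q * (conj (conj α) * conj β)         ≡⟨ cong (λ t → ofℚ q * (t * conj β)) (conj-involutive α) ⟩
    ofℚ q * (α * conj β)                     ≡⟨ cong (λ t → ofℚ q * t) (⊛-comm α (conj β)) ⟩
    ofℚ q * (conj β * α)                     ∎
    where open ≡-Reasoning

  ⟨⟩-conj-symmetric : ∀ h v w → ⟨ w ∣ toM h ∣ v ⟩ ≡ conj ⟨ v ∣ toM h ∣ w ⟩
  ⟨⟩-conj-symmetric (herm a b c) (α , γ) (β , δ) = begin
    ⟨ (β , δ) ∣ toM (herm a b c) ∣ (α , γ) ⟩
      ≡⟨ ⟨⟩-expand a b c β δ α γ ⟩
    ofℚ a * (conj β * α) + ofℚ c * (conj δ * γ) + (conj β * γ * b + conj (conj α * δ * b))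
      ≡⟨ cong₂ (λ s t → s + t + (conj β * γ * b + conj (conj α * δ * b))) (conj[q*conj[α]*β] a α β) (conj[q*conj[α]*β] c γ δ) ⟨
    conj (ofℚ a * (conj α * β)) + conj (ofℚ c * (conj γ * δ)) + (conj β * γ * b + conj (conj α * δ * b))
      ≡⟨ cong (λ t → conj (ofℚ a * (conj α * β)) + conj (ofℚ c * (conj γ * δ)) + t)
              (trans (cong (λ t → conj (conj α * δ * b) + t) (conj-involutive (conj β * γ * b)))
                     (⊕-comm (conj (conj α * δ * b)) (conj β * γ * b))) ⟨
    conj (ofℚ a * (conj α * β)) + conj (ofℚ c * (conj γ * δ)) + (conj (conj α * δ * b) + conj (conj (conj β * γ * b)))
      ≡⟨ conj-⊕₃ (ofℚ a * (conj α * β)) (ofℚ c * (conj γ * δ)) (conj α * δ * b) (conj (conj β * γ * b)) ⟨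
    conj (ofℚ a * (conj α * β) + ofℚ c * (conj γ * δ) + (conj α * δ * b + conj (conj β * γ * b)))
      ≡⟨ cong conj (⟨⟩-expand a b c α γ β δ) ⟨
    conj ⟨ (α , γ) ∣ toM (herm a b c) ∣ (β , δ) ⟩ ∎
    where
    open ≡-Reasoning
    conj-⊕₃ : ∀ x y z t → conj (x + y + (z + t)) ≡ conj x + conj y + (conj z + conj t)
    conj-⊕₃ x y z t = trans (conj-⊕ (x + y) (z + t)) (cong₂ _+_ (conj-⊕ x y) (conj-⊕ z t))

  ⟪_,_⟫ : OF → F → ℚ
  ⟪ w , b ⟫ = Tr (ι w * b)

  record _HasCoords_ (h : SQ) (x : Coords) : Set where
    open Coords x
    field
      a-coord : ha h ≡ fromℤ a
      c-coord : hc h ≡ fromℤ c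
      P-coord : ⟪ 1ₒ , hb h ⟫ ≡ fromℤ P
      Q-coord : ⟪ ωₒ , hb h ⟫ ≡ fromℤ Q

  conj[ια]*ιβ : ∀ α β → conj (ι α) * ι β ≡ ι (conjₒ α ·ₒ β)
  conj[ια]*ιβ α β = trans (cong (λ t → t * ι β) (sym (ι-conjₒ α))) (sym (ι-·ₒ (conjₒ α) β))

  conj[ια]*ια : ∀ α → conj (ι α) * ι α ≡ ιℤ (normₒ α)
  conj[ια]*ια α with conj[ια]*ιβ α α
  ... | eq rewrite conjₒ[α]·ₒα-real α = eq

  Tr-ι : ∀ w → Tr (ι w) ≡ fromℤ (trₒ w)
  Tr-ι w = cong re (trans (cong (λ t → ι w + t) (sym (ι-conjₒ w))) (sym (ι-+ₒ w (conjₒ w))))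

  ⟪⟫-coords : ∀ {b P Q} → ⟪ 1ₒ , b ⟫ ≡ fromℤ P → ⟪ ωₒ , b ⟫ ≡ fromℤ Q → ∀ w → ⟪ w , b ⟫ ≡ fromℤ (pairₒ w P Q)
  ⟪⟫-coords {b} {P} {Q} P≡ Q≡ (u + v ω') = begin
    Tr (ι (u + v ω') * b)
      ≡⟨ cong (λ t → Tr (t * b)) (ι-decompose u v) ⟩
    Tr ((ιℤ u * ι 1ₒ + ιℤ v * ι ωₒ) * b)
      ≡⟨ cong Tr (solve 5 (λ u v one ω b → (u :* one :+ v :* ω) :* b := u :* (one :* b) :+ v :* (ω :* b))
                    refl (ιℤ u) (ιℤ v) (ι 1ₒ) (ι ωₒ) b) ⟩
    Tr (ιℤ u * (ι 1ₒ * b) + ιℤ v * (ι ωₒ * b))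
      ≡⟨ Tr-⊕ (ιℤ u * (ι 1ₒ * b)) (ιℤ v * (ι ωₒ * b)) ⟩
    Tr (ιℤ u * (ι 1ₒ * b)) ℚ.+ Tr (ιℤ v * (ι ωₒ * b))
      ≡⟨ cong₂ ℚ._+_ (Tr-ofℚ⊛ (fromℤ u) (ι 1ₒ * b)) (Tr-ofℚ⊛ (fromℤ v) (ι ωₒ * b)) ⟩
    fromℤ u ℚ.* ⟪ 1ₒ , b ⟫ ℚ.+ fromℤ v ℚ.* ⟪ ωₒ , b ⟫
      ≡⟨ cong₂ (λ s t → fromℤ u ℚ.* s ℚ.+ fromℤ v ℚ.* t) P≡ Q≡ ⟩
    fromℤ u ℚ.* fromℤ P ℚ.+ fromℤ v ℚ.* fromℤ Q
      ≡⟨ cong₂ ℚ._+_ (fromℤ-homo-* u P) (fromℤ-homo-* v Q) ⟨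
    fromℤ (u ℤ.* P) ℚ.+ fromℤ (v ℤ.* Q)
      ≡⟨ fromℤ-homo-+ (u ℤ.* P) (v ℤ.* Q) ⟨
    fromℤ (u ℤ.* P ℤ.+ v ℤ.* Q) ∎
    where open ≡-Reasoning

  ιᵥ : OF × OF → F × F
  ιᵥ (α , γ) = (ι α , ι γ)

  ⟨⟩-diag-integral : ∀ {h x} → h HasCoords x → ∀ v → ⟨ ιᵥ v ∣ toM h ∣ ιᵥ v ⟩ ≡ ιℤ (quad x v)
  ⟨⟩-diag-integral {herm a b c} {x} hx (α , γ) = begin
    ⟨ ιᵥ (α , γ) ∣ toM (herm a b c) ∣ ιᵥ (α , γ) ⟩
      ≡⟨ ⟨⟩-expand a b c (ι α) (ι γ) (ι α) (ι γ) ⟩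
    ofℚ a * (conj (ι α) * ι α) + ofℚ c * (conj (ι γ) * ι γ) + (w * b + conj (w * b))
      ≡⟨ cong₂ _+_ (cong₂ _+_ (cong₂ _*_ (cong ofℚ a-coord) (conj[ια]*ια α)) (cong₂ _*_ (cong ofℚ c-coord) (conj[ια]*ια γ)))
                   (x⊕conj[x]≡ofℚ[Tr[x]] (w * b)) ⟩
    ιℤ A * ιℤ (normₒ α) + ιℤ C * ιℤ (normₒ γ) + ofℚ (Tr (w * b))
      ≡⟨ cong (λ t → ιℤ A * ιℤ (normₒ α) + ιℤ C * ιℤ (normₒ γ) + ofℚ (Tr (t * b))) (conj[ια]*ιβ α γ) ⟩
    ιℤ A * ιℤ (normₒ α) + ιℤ C * ιℤ (normₒ γ) + ofℚ ⟪ conjₒ α ·ₒ γ , b ⟫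
      ≡⟨ cong (λ t → ιℤ A * ιℤ (normₒ α) + ιℤ C * ιℤ (normₒ γ) + ofℚ t) (⟪⟫-coords {b} {P} {Q} P-coord Q-coord (conjₒ α ·ₒ γ)) ⟩
    ιℤ A * ιℤ (normₒ α) + ιℤ C * ιℤ (normₒ γ) + ιℤ (pairₒ (conjₒ α ·ₒ γ) P Q)
      ≡⟨ cong (λ t → t + ιℤ (pairₒ (conjₒ α ·ₒ γ) P Q)) (cong₂ _+_ (ιℤ-homo-* A (normₒ α)) (ιℤ-homo-* C (normₒ γ))) ⟨
    ιℤ (A ℤ.* normₒ α) + ιℤ (C ℤ.* normₒ γ) + ιℤ (pairₒ (conjₒ α ·ₒ γ) P Q)
      ≡⟨ cong (λ t → t + ιℤ (pairₒ (conjₒ α ·ₒ γ) P Q)) (ιℤ-homo-+ (A ℤ.* normₒ α) (C ℤ.* normₒ γ)) ⟨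
    ιℤ (A ℤ.* normₒ α ℤ.+ C ℤ.* normₒ γ) + ιℤ (pairₒ (conjₒ α ·ₒ γ) P Q)
      ≡⟨ ιℤ-homo-+ (A ℤ.* normₒ α ℤ.+ C ℤ.* normₒ γ) (pairₒ (conjₒ α ·ₒ γ) P Q) ⟨
    ιℤ (quad x (α , γ)) ∎
    where
    open ≡-Reasoning
    open Coords x renaming (a to A; c to C)
    open _HasCoords_ hx
    w = conj (ι α) * ι γ

  ι[t]*conj[ια]*ιβ : ∀ t α β → ι t * (conj (ι α) * ι β) ≡ ι (t ·ₒ (conjₒ α ·ₒ β))
  ι[t]*conj[ια]*ιβ t α β = trans (cong (λ s → ι t * s) (conj[ια]*ιβ α β)) (sym (ι-·ₒ t (conjₒ α ·ₒ β)))

  conj[ιt]*conj[ια]*ιβ : ∀ t α β → conj (ι t) * (conj (ι α) * ι β) ≡ ι (conjₒ t ·ₒ (conjₒ α ·ₒ β))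
  conj[ιt]*conj[ια]*ιβ t α β = trans (cong (λ s → conj (ι t) * s) (conj[ια]*ιβ α β)) (conj[ια]*ιβ t (conjₒ α ·ₒ β))

  Tr[x*conj[y]] : ∀ x y → Tr (x * conj y) ≡ Tr (conj x * y)
  Tr[x*conj[y]] x y = begin
    Tr (x * conj y)                ≡⟨ cong (λ s → Tr (s * conj y)) (conj-involutive x) ⟨
    Tr (conj (conj x) * conj y)    ≡⟨ cong Tr (conj-⊛ (conj x) y) ⟨
    Tr (conj (conj x * y))         ≡⟨ Tr-conj (conj x * y) ⟩
    Tr (conj x * y)                ∎
    where open ≡-Reasoning

  Tr[ιt*conj[ια]*ιβ*b] : ∀ t α β b → Tr (ι t * (conj (ι α) * ι β) * b) ≡ ⟪ t ·ₒ (conjₒ α ·ₒ β) , b ⟫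
  Tr[ιt*conj[ια]*ιβ*b] t α β b = cong (λ s → Tr (s * b)) (ι[t]*conj[ια]*ιβ t α β)

  Tr[ιt*conj[conj[ια]*ιβ*b]] : ∀ t α β b → Tr (ι t * conj (conj (ι α) * ι β * b)) ≡ ⟪ conjₒ t ·ₒ (conjₒ α ·ₒ β) , b ⟫
  Tr[ιt*conj[conj[ια]*ιβ*b]] t α β b = begin
    Tr (ι t * conj (conj (ι α) * ι β * b))       ≡⟨ Tr[x*conj[y]] (ι t) (conj (ι α) * ι β * b) ⟩
    Tr (conj (ι t) * (conj (ι α) * ι β * b))     ≡⟨ cong Tr (⊛-assoc (conj (ι t)) (conj (ι α) * ι β) b) ⟨
    Tr (conj (ι t) * (conj (ι α) * ι β) * b)     ≡⟨ cong (λ s → Tr (s * b)) (conj[ιt]*conj[ια]*ιβ t α β) ⟩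
    ⟪ conjₒ t ·ₒ (conjₒ α ·ₒ β) , b ⟫            ∎
    where open ≡-Reasoning

  ⟨⟩-pairing-integral : ∀ {h x} → h HasCoords x → ∀ t v w → ⟪ t , ⟨ ιᵥ v ∣ toM h ∣ ιᵥ w ⟩ ⟫ ≡ fromℤ (bil t x v w)
  ⟨⟩-pairing-integral {herm a b c} {x} hx t (α , γ) (β , δ) = begin
    Tr (ι t * ⟨ ιᵥ (α , γ) ∣ toM (herm a b c) ∣ ιᵥ (β , δ) ⟩)
      ≡⟨ cong (λ E → Tr (ι t * E)) (⟨⟩-expand a b c (ι α) (ι γ) (ι β) (ι δ)) ⟩
    Tr (ι t * (ofℚ a * w₁ + ofℚ c * w₂ + (w₃ * b + conj (w₄ * b))))
      ≡⟨ cong Tr (solve 8 (λ τ a c w₁ w₂ w₃ b z → τ :* (a :* w₁ :+ c :* w₂ :+ (w₃ :* b :+ z))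
                                                  := a :* (τ :* w₁) :+ c :* (τ :* w₂) :+ (τ :* w₃ :* b :+ τ :* z))
                    refl (ι t) (ofℚ a) (ofℚ c) w₁ w₂ w₃ b (conj (w₄ * b))) ⟩
    Tr (ofℚ a * (ι t * w₁) + ofℚ c * (ι t * w₂) + (ι t * w₃ * b + ι t * conj (w₄ * b)))
      ≡⟨ trans (Tr-⊕ (ofℚ a * (ι t * w₁) + ofℚ c * (ι t * w₂)) (ι t * w₃ * b + ι t * conj (w₄ * b)))
               (cong₂ ℚ._+_ (Tr-⊕ (ofℚ a * (ι t * w₁)) (ofℚ c * (ι t * w₂))) (Tr-⊕ (ι t * w₃ * b) (ι t * conj (w₄ * b)))) ⟩
    Tr (ofℚ a * (ι t * w₁)) ℚ.+ Tr (ofℚ c * (ι t * w₂)) ℚ.+ (Tr (ι t * w₃ * b) ℚ.+ Tr (ι t * conj (w₄ * b)))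
      ≡⟨ cong₂ ℚ._+_ (cong₂ ℚ._+_ (scaled-trace {n = A} a-coord α β) (scaled-trace {n = C} c-coord γ δ))
                     (cong₂ ℚ._+_ (trans (Tr[ιt*conj[ια]*ιβ*b] t α δ b) (pairing (t ·ₒ (conjₒ α ·ₒ δ))))
                                  (trans (Tr[ιt*conj[conj[ια]*ιβ*b]] t β γ b) (pairing (conjₒ t ·ₒ (conjₒ β ·ₒ γ))))) ⟩
    fromℤ A ℚ.* fromℤ (trₒ (t ·ₒ (conjₒ α ·ₒ β))) ℚ.+ fromℤ C ℚ.* fromℤ (trₒ (t ·ₒ (conjₒ γ ·ₒ δ)))
      ℚ.+ (fromℤ (pairₒ (t ·ₒ (conjₒ α ·ₒ δ)) P Q) ℚ.+ fromℤ (pairₒ (conjₒ t ·ₒ (conjₒ β ·ₒ γ)) P Q))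
      ≡⟨ fromℤ-homo-linear₄ A (trₒ (t ·ₒ (conjₒ α ·ₒ β))) C (trₒ (t ·ₒ (conjₒ γ ·ₒ δ))) (pairₒ (t ·ₒ (conjₒ α ·ₒ δ)) P Q) (pairₒ (conjₒ t ·ₒ (conjₒ β ·ₒ γ)) P Q) ⟨
    fromℤ (bil t x (α , γ) (β , δ)) ∎
    where
    open ≡-Reasoning
    open Coords x renaming (a to A; c to C)
    open _HasCoords_ hx
    pairing : ∀ w → ⟪ w , b ⟫ ≡ fromℤ (pairₒ w P Q)
    pairing = ⟪⟫-coords {b} {P} {Q} P-coord Q-coord
    w₁ = conj (ι α) * ι β
    w₂ = conj (ι γ) * ι δ
    w₃ = conj (ι α) * ι δ
    w₄ = conj (ι β) * ι γ
    scaled-trace : ∀ {q n} → q ≡ fromℤ n → ∀ α β → Tr (ofℚ q * (ι t * (conj (ι α) * ι β))) ≡ fromℤ n ℚ.* fromℤ (trₒ (t ·ₒ (conjₒ α ·ₒ β)))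
    scaled-trace {q} q≡n α β = trans (Tr-ofℚ⊛ q (ι t * (conj (ι α) * ι β)))
      (cong₂ ℚ._*_ q≡n (trans (cong Tr (ι[t]*conj[ια]*ιβ t α β)) (Tr-ι (t ·ₒ (conjₒ α ·ₒ β)))))

-- The lattice T

module Hermitian (D K : ℤ) (Nω≡K : Field.Nω D ≡ fromℤ K) where
  open Field D
  open FieldProperties D K Nω≡K

  mat-cong : ∀ {a b c d a′ b′ c′ d′ : F} → a ≡ a′ → b ≡ b′ → c ≡ c′ → d ≡ d′ → mat a b c d ≡ mat a′ b′ c′ d′
  mat-cong refl refl refl refl = refl

  trace-formula : ∀ g h → tr (toM (ιS g) · toM h) ≡ ofℚ (fromℤ (SZ.za g) ℚ.* ha h ℚ.+ fromℤ (SZ.zc g) ℚ.* hc h ℚ.+ ⟪ conjₒ (SZ.zb g) , hb h ⟫)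
  trace-formula (hermZ ga gb gc) (herm a b c) = begin
    ofℚ (fromℤ ga) * ofℚ a + ι gb * conj b + (conj (ι gb) * b + ofℚ (fromℤ gc) * ofℚ c)
      ≡⟨ solve 6 (λ ga a gc c x y → ga :* a :+ x :+ (y :+ gc :* c) := ga :* a :+ gc :* c :+ (y :+ x))
           refl (ofℚ (fromℤ ga)) (ofℚ a) (ofℚ (fromℤ gc)) (ofℚ c) (ι gb * conj b) (conj (ι gb) * b) ⟩
    ofℚ (fromℤ ga) * ofℚ a + ofℚ (fromℤ gc) * ofℚ c + (conj (ι gb) * b + ι gb * conj b)
      ≡⟨ cong (λ t → ofℚ (fromℤ ga) * ofℚ a + ofℚ (fromℤ gc) * ofℚ c + (conj (ι gb) * b + t)) ι[gb]*conj[b] ⟩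
    ofℚ (fromℤ ga) * ofℚ a + ofℚ (fromℤ gc) * ofℚ c + (conj (ι gb) * b + conj (conj (ι gb) * b))
      ≡⟨ cong₂ _+_ (cong₂ _+_ (sym (ofℚ-homo-* (fromℤ ga) a)) (sym (ofℚ-homo-* (fromℤ gc) c))) (x⊕conj[x]≡ofℚ[Tr[x]] (conj (ι gb) * b)) ⟩
    ofℚ (fromℤ ga ℚ.* a) + ofℚ (fromℤ gc ℚ.* c) + ofℚ (Tr (conj (ι gb) * b))
      ≡⟨ cong (λ t → ofℚ (fromℤ ga ℚ.* a) + ofℚ (fromℤ gc ℚ.* c) + ofℚ (Tr (t * b))) (ι-conjₒ gb) ⟨
    ofℚ (fromℤ ga ℚ.* a) + ofℚ (fromℤ gc ℚ.* c) + ofℚ ⟪ conjₒ gb , b ⟫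
      ≡⟨ trans (cong (λ t → t + ofℚ ⟪ conjₒ gb , b ⟫) (ofℚ-homo-+ (fromℤ ga ℚ.* a) (fromℤ gc ℚ.* c)))
               (ofℚ-homo-+ (fromℤ ga ℚ.* a ℚ.+ fromℤ gc ℚ.* c) ⟪ conjₒ gb , b ⟫) ⟨
    ofℚ (fromℤ ga ℚ.* a ℚ.+ fromℤ gc ℚ.* c ℚ.+ ⟪ conjₒ gb , b ⟫) ∎
    where
    open ≡-Reasoning
    ι[gb]*conj[b] : ι gb * conj b ≡ conj (conj (ι gb) * b)
    ι[gb]*conj[b] = sym (trans (conj-⊛ (conj (ι gb)) b) (cong (λ t → t * conj b) (conj-involutive (ι gb))))

  infixl 7 _•ₕ_
  _•ₕ_ : ℚ → SQ → SQ
  q •ₕ herm a b c = herm (q ℚ.* a) (ofℚ q * b) (q ℚ.* c)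

  •-toM : ∀ q h → q • toM h ≡ toM (q •ₕ h)
  •-toM q (herm a b c) = mat-cong (sym (ofℚ-homo-* q a)) refl ofℚ[q]*conj[b] (sym (ofℚ-homo-* q c))
    where
    ofℚ[q]*conj[b] : ofℚ q * conj b ≡ conj (ofℚ q * b)
    ofℚ[q]*conj[b] = sym (trans (conj-⊛ (ofℚ q) b) (cong (λ t → t * conj b) (conj-ofℚ q)))

  ⟪⟫-scale : ∀ w q b → ⟪ w , ofℚ q * b ⟫ ≡ q ℚ.* ⟪ w , b ⟫
  ⟪⟫-scale w q b = trans (cong Tr (solve 3 (λ w q b → w :* (q :* b) := q :* (w :* b)) refl (ι w) (ofℚ q) b))
                         (Tr-ofℚ⊛ q (ι w * b))

  -- tr (g h) for g ∈ S(ℤ), in terms of the coordinates of h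
  ⟨_,_⟩ : SZ → Coords → ℤ
  ⟨ hermZ ga gb gc , x ⟩ = ga ℤ.* a ℤ.+ gc ℤ.* c ℤ.+ pairₒ (conjₒ gb) P Q
    where open Coords x

  trace-coords : ∀ {h x} → h HasCoords x → ∀ g →
    fromℤ (SZ.za g) ℚ.* ha h ℚ.+ fromℤ (SZ.zc g) ℚ.* hc h ℚ.+ ⟪ conjₒ (SZ.zb g) , hb h ⟫ ≡ fromℤ ⟨ g , x ⟩
  trace-coords {h} {x} hx (hermZ ga gb gc) = begin
    fromℤ ga ℚ.* ha h ℚ.+ fromℤ gc ℚ.* hc h ℚ.+ ⟪ conjₒ gb , hb h ⟫
      ≡⟨ cong₂ ℚ._+_ (cong₂ (λ s t → fromℤ ga ℚ.* s ℚ.+ fromℤ gc ℚ.* t) a-coord c-coord)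
                     (⟪⟫-coords {hb h} {P} {Q} P-coord Q-coord (conjₒ gb)) ⟩
    fromℤ ga ℚ.* fromℤ A ℚ.+ fromℤ gc ℚ.* fromℤ C ℚ.+ fromℤ (pairₒ (conjₒ gb) P Q)
      ≡⟨ fromℤ-homo-linear₃ ga A gc C (pairₒ (conjₒ gb) P Q) ⟨
    fromℤ ⟨ hermZ ga gb gc , x ⟩ ∎
    where
    open ≡-Reasoning
    open Coords x renaming (a to A; c to C)
    open _HasCoords_ hx

  trace-integral : ∀ {h x} → h HasCoords x → ∀ g → tr (toM (ιS g) · toM h) ≡ ofℚ (fromℤ ⟨ g , x ⟩)
  trace-integral {h} hx g = trans (trace-formula g h) (cong ofℚ (trace-coords hx g))

  trace-scaled : ∀ {h x} → h HasCoords x → ∀ q g → tr (toM (ιS g) · (q • toM h)) ≡ ofℚ (q ℚ.* fromℤ ⟨ g , x ⟩)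
  trace-scaled {h@(herm a b c)} hx q g@(hermZ ga gb gc) = begin
    tr (toM (ιS g) · (q • toM h))
      ≡⟨ cong (λ X → tr (toM (ιS g) · X)) (•-toM q h) ⟩
    tr (toM (ιS g) · toM (q •ₕ h))
      ≡⟨ trace-formula g (q •ₕ h) ⟩
    ofℚ (fromℤ ga ℚ.* (q ℚ.* a) ℚ.+ fromℤ gc ℚ.* (q ℚ.* c) ℚ.+ ⟪ conjₒ gb , ofℚ q * b ⟫)
      ≡⟨ cong (λ t → ofℚ (fromℤ ga ℚ.* (q ℚ.* a) ℚ.+ fromℤ gc ℚ.* (q ℚ.* c) ℚ.+ t)) (⟪⟫-scale (conjₒ gb) q b) ⟩
    ofℚ (fromℤ ga ℚ.* (q ℚ.* a) ℚ.+ fromℤ gc ℚ.* (q ℚ.* c) ℚ.+ q ℚ.* ⟪ conjₒ gb , b ⟫)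
      ≡⟨ cong ofℚ (factor (fromℤ ga) (fromℤ gc) q a c ⟪ conjₒ gb , b ⟫) ⟩
    ofℚ (q ℚ.* (fromℤ ga ℚ.* a ℚ.+ fromℤ gc ℚ.* c ℚ.+ ⟪ conjₒ gb , b ⟫))
      ≡⟨ cong (λ t → ofℚ (q ℚ.* t)) (trace-coords hx g) ⟩
    ofℚ (q ℚ.* fromℤ ⟨ g , _ ⟩) ∎
    where
    open ≡-Reasoning
    factor : ∀ ga gc q a c t → ga ℚ.* (q ℚ.* a) ℚ.+ gc ℚ.* (q ℚ.* c) ℚ.+ q ℚ.* t ≡ q ℚ.* (ga ℚ.* a ℚ.+ gc ℚ.* c ℚ.+ t)
    factor = Solver.solve-∀ ℚ-ring

  HasCoords⇒InT : ∀ {h x} → h HasCoords x → InT h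
  HasCoords⇒InT {x = x} hx g = ⟨ g , x ⟩ , trace-integral hx g

  InT⇒HasCoords : ∀ {h} → InT h → ∃[ x ] h HasCoords x
  InT⇒HasCoords {herm a b c} h∈T =
    coords A C P Q , record
      { a-coord = trans (sym (only-a a c b)) A≡
      ; c-coord = trans (sym (only-c a c b)) C≡
      ; P-coord = trans (sym (only-pairing a c ⟪ 1ₒ , b ⟫)) P≡
      ; Q-coord = trans (sym (trans (only-pairing a c ⟪ conjₒ (conjₒ ωₒ) , b ⟫)
                                    (cong (λ w → ⟪ w , b ⟫) (conjₒ-involutive ωₒ)))) Q≡ }
    where
    integral : ∀ g → ∃[ z ] fromℤ (SZ.za g) ℚ.* a ℚ.+ fromℤ (SZ.zc g) ℚ.* c ℚ.+ ⟪ conjₒ (SZ.zb g) , b ⟫ ≡ fromℤ z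
    integral g with h∈T g
    ... | z , tr≡z = z , cong re (trans (sym (trace-formula g (herm a b c))) tr≡z)
    A = proj₁ (integral (hermZ (+ 1) 0ₒ (+ 0)))
    A≡ = proj₂ (integral (hermZ (+ 1) 0ₒ (+ 0)))
    C = proj₁ (integral (hermZ (+ 0) 0ₒ (+ 1)))
    C≡ = proj₂ (integral (hermZ (+ 0) 0ₒ (+ 1)))
    P = proj₁ (integral (hermZ (+ 0) 1ₒ (+ 0)))
    P≡ = proj₂ (integral (hermZ (+ 0) 1ₒ (+ 0)))
    Q = proj₁ (integral (hermZ (+ 0) (conjₒ ωₒ) (+ 0)))
    Q≡ = proj₂ (integral (hermZ (+ 0) (conjₒ ωₒ) (+ 0)))
    only-a : ∀ a c b → 1ℚ ℚ.* a ℚ.+ 0ℚ ℚ.* c ℚ.+ ⟪ 0ₒ , b ⟫ ≡ a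
    only-a a c b = trans (cong (λ t → 1ℚ ℚ.* a ℚ.+ 0ℚ ℚ.* c ℚ.+ t) (Tr-ofℚ⊛ 0ℚ b)) (eq a c (Tr b))
      where
      eq : ∀ a c t → 1ℚ ℚ.* a ℚ.+ 0ℚ ℚ.* c ℚ.+ 0ℚ ℚ.* t ≡ a
      eq = Solver.solve-∀ ℚ-ring
    only-c : ∀ a c b → 0ℚ ℚ.* a ℚ.+ 1ℚ ℚ.* c ℚ.+ ⟪ 0ₒ , b ⟫ ≡ c
    only-c a c b = trans (cong (λ t → 0ℚ ℚ.* a ℚ.+ 1ℚ ℚ.* c ℚ.+ t) (Tr-ofℚ⊛ 0ℚ b)) (eq a c (Tr b))
      where
      eq : ∀ a c t → 0ℚ ℚ.* a ℚ.+ 1ℚ ℚ.* c ℚ.+ 0ℚ ℚ.* t ≡ c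
      eq = Solver.solve-∀ ℚ-ring
    only-pairing : ∀ a c t → 0ℚ ℚ.* a ℚ.+ 0ℚ ℚ.* c ℚ.+ t ≡ t
    only-pairing = Solver.solve-∀ ℚ-ring

  InZℓ-scaled⇔∣ : ∀ {ℓ} → Prime ℓ → ∀ m L → InZℓ ℓ (ofℚ (invPow ℓ m ℚ.* fromℤ L)) ⇔ + (ℓ ^ m) ℤ∣.∣ L
  InZℓ-scaled⇔∣ {zero} pr = λ _ _ → ⊥-elim (¬prime[0] pr)
  InZℓ-scaled⇔∣ {suc l} pr m L = mk⇔
    (λ { (q , ofℚ≡ofℚ , ℓ∤↧q) → pow∣numerator pr m L q (sym (cong re ofℚ≡ofℚ)) ℓ∤↧q })
    (λ { (divides w L≡wℓᵐ) → fromℤ w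
         , cong ofℚ (trans (cong (λ t → invPow (suc l) m ℚ.* fromℤ t) (trans L≡wℓᵐ (ℤP.*-comm w (+ (suc l ^ m)))))
                           (1/n*fromℤ[n*z]≡fromℤ[z] (suc l ^ m) w))
         , λ ℓ∣↧ → ¬prime[1] (subst Prime (ℕ∣.∣1⇒≡1 (subst (suc l ℕ∣.∣_) (↧ₙ-fromℤ w) ℓ∣↧)) pr) })
    where instance _ = ℕP.m^n≢0 (suc l) m

  ∣ᶜ⇒∣⟨⟩ : ∀ {k x} → k ∣ᶜ x → ∀ g → k ℤ∣.∣ ⟨ g , x ⟩
  ∣ᶜ⇒∣⟨⟩ {x = coords a c P Q} (k∣a , k∣c , k∣P , k∣Q) (hermZ ga gb gc) =
    ℤ∣.∣m∣n⇒∣m+n (ℤ∣.∣m∣n⇒∣m+n (ℤ∣.∣n⇒∣m*n ga k∣a) (ℤ∣.∣n⇒∣m*n gc k∣c))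
                 (ℤ∣.∣m∣n⇒∣m+n (ℤ∣.∣n⇒∣m*n (reZ (conjₒ gb)) k∣P) (ℤ∣.∣n⇒∣m*n (imZ (conjₒ gb)) k∣Q))

  InTℓ⇒∣⟨⟩ : ∀ {ℓ h x} → Prime ℓ → h HasCoords x → ∀ m → InTℓ ℓ m h → ∀ g → + (ℓ ^ m) ℤ∣.∣ ⟨ g , x ⟩
  InTℓ⇒∣⟨⟩ {ℓ} {h} {x} pr hx m t g = Equivalence.to (InZℓ-scaled⇔∣ pr m ⟨ g , x ⟩) (subst (InZℓ ℓ) (trace-scaled hx (invPow ℓ m) g) (t g))

  ⟨⟩-basis : ∀ a c P Q →
    (⟨ hermZ (+ 1) 0ₒ (+ 0) , coords a c P Q ⟩ ≡ a) × (⟨ hermZ (+ 0) 0ₒ (+ 1) , coords a c P Q ⟩ ≡ c) ×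
    (⟨ hermZ (+ 0) 1ₒ (+ 0) , coords a c P Q ⟩ ≡ P) × (⟨ hermZ (+ 0) (conjₒ ωₒ) (+ 0) , coords a c P Q ⟩ ≡ Q)
  ⟨⟩-basis a c P Q = only-a a c P Q , only-c a c P Q , only-P a c P Q
    , trans (cong (λ w → + 0 ℤ.* a ℤ.+ + 0 ℤ.* c ℤ.+ pairₒ w P Q) (conjₒ-involutive ωₒ)) (only-Q a c P Q)
    where
    only-a : ∀ a c P Q → + 1 ℤ.* a ℤ.+ + 0 ℤ.* c ℤ.+ (+ 0 ℤ.* P ℤ.+ + 0 ℤ.* Q) ≡ a
    only-a = ℤ-Solver.solve-∀
    only-c : ∀ a c P Q → + 0 ℤ.* a ℤ.+ + 1 ℤ.* c ℤ.+ (+ 0 ℤ.* P ℤ.+ + 0 ℤ.* Q) ≡ c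
    only-c = ℤ-Solver.solve-∀
    only-P : ∀ a c P Q → + 0 ℤ.* a ℤ.+ + 0 ℤ.* c ℤ.+ (+ 1 ℤ.* P ℤ.+ + 0 ℤ.* Q) ≡ P
    only-P = ℤ-Solver.solve-∀
    only-Q : ∀ a c P Q → + 0 ℤ.* a ℤ.+ + 0 ℤ.* c ℤ.+ (+ 0 ℤ.* P ℤ.+ + 1 ℤ.* Q) ≡ Q
    only-Q = ℤ-Solver.solve-∀

  ∣ᶜ⇒InTℓ : ∀ {ℓ h x} → Prime ℓ → h HasCoords x → ∀ m → + (ℓ ^ m) ∣ᶜ x → InTℓ ℓ m h
  ∣ᶜ⇒InTℓ {ℓ} {h} {x} pr hx m ℓᵐ∣x g = subst (InZℓ ℓ) (sym (trace-scaled hx (invPow ℓ m) g))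
                  (Equivalence.from (InZℓ-scaled⇔∣ pr m ⟨ g , x ⟩) (∣ᶜ⇒∣⟨⟩ ℓᵐ∣x g))

  InTℓ⇒∣ᶜ : ∀ {ℓ h x} → Prime ℓ → h HasCoords x → ∀ m → InTℓ ℓ m h → + (ℓ ^ m) ∣ᶜ x
  InTℓ⇒∣ᶜ {ℓ} {h} {x@(coords a c P Q)} pr hx m t =
    at (hermZ (+ 1) 0ₒ (+ 0)) (proj₁ basis) , at (hermZ (+ 0) 0ₒ (+ 1)) (proj₁ (proj₂ basis)) ,
    at (hermZ (+ 0) 1ₒ (+ 0)) (proj₁ (proj₂ (proj₂ basis))) , at (hermZ (+ 0) (conjₒ ωₒ) (+ 0)) (proj₂ (proj₂ (proj₂ basis)))
    where
    basis = ⟨⟩-basis a c P Q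
    at : ∀ g {y} → ⟨ g , x ⟩ ≡ y → + (ℓ ^ m) ℤ∣.∣ y
    at g eq = subst (λ s → + (ℓ ^ m) ℤ∣.∣ s) eq (InTℓ⇒∣⟨⟩ pr hx m t g)

  toM-⊟-diag : ∀ h N a d → toM h ⊟ diag N a d ≡ toM (herm (ha h ℚ.- fromℤ (+ (N ℕ.* a))) (hb h) (hc h ℚ.- fromℤ (+ (N ℕ.* d))))
  toM-⊟-diag (herm a b c) N a′ d′ = mat-cong (F-ext refl refl) (⊕-identityʳ b) (⊕-identityʳ (conj b)) (F-ext refl refl)

  HasCoords-⊟-diag : ∀ {h x} → h HasCoords x → ∀ N a d →
    herm (ha h ℚ.- fromℤ (+ (N ℕ.* a))) (hb h) (hc h ℚ.- fromℤ (+ (N ℕ.* d)))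
      HasCoords coords (Coords.a x ℤ.- + (N ℕ.* a)) (Coords.c x ℤ.- + (N ℕ.* d)) (Coords.P x) (Coords.Q x)
  HasCoords-⊟-diag {x = coords A C P Q} hx N a d = record
    { a-coord = trans (cong (ℚ._- fromℤ (+ (N ℕ.* a))) a-coord) (sym (fromℤ-homo-- A (+ (N ℕ.* a))))
    ; c-coord = trans (cong (ℚ._- fromℤ (+ (N ℕ.* d))) c-coord) (sym (fromℤ-homo-- C (+ (N ℕ.* d))))
    ; P-coord = P-coord
    ; Q-coord = Q-coord }
    where open _HasCoords_ hx

  InPowT-intro : ∀ {h x} p .{{_ : ℕ.NonZero p}} n → h HasCoords x → + (p ^ n) ∣ᶜ x → InPowT p n (toM h)
  InPowT-intro {herm a b c} {coords A C P Q} p n hx (divides a′ A≡ , divides c′ C≡ , divides P′ P≡ , divides Q′ Q≡) =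
    k , HasCoords⇒InT k-coords , mat-cong (scale-ℤ {a} {A} {a′} a-coord A≡) b≡pⁿr*b conj[b]≡ (scale-ℤ {c} {C} {c′} c-coord C≡)
    where
    open _HasCoords_ hx
    instance _ = ℕP.m^n≢0 p n
    pⁿ = p ^ n
    r = + 1 ℚ./ pⁿ
    k = herm (fromℤ a′) (ofℚ r * b) (fromℤ c′)
    cancel : ∀ z → r ℚ.* fromℤ (z ℤ.* + pⁿ) ≡ fromℤ z
    cancel z = trans (cong (λ t → r ℚ.* fromℤ t) (ℤP.*-comm z (+ pⁿ))) (1/n*fromℤ[n*z]≡fromℤ[z] pⁿ z)
    scaled-pairing : ∀ {w V V′} → ⟪ w , b ⟫ ≡ fromℤ V → V ≡ V′ ℤ.* + pⁿ → ⟪ w , ofℚ r * b ⟫ ≡ fromℤ V′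
    scaled-pairing {w} {V} {V′} V-coord V≡ = trans (⟪⟫-scale w r b) (trans (cong (r ℚ.*_) (trans V-coord (cong fromℤ V≡))) (cancel V′))
    k-coords : k HasCoords coords a′ c′ P′ Q′
    k-coords = record { a-coord = refl ; c-coord = refl ; P-coord = scaled-pairing {1ₒ} {P} {P′} P-coord P≡ ; Q-coord = scaled-pairing {ωₒ} {Q} {Q′} Q-coord Q≡ }
    scale-ℤ : ∀ {q Z z} → q ≡ fromℤ Z → Z ≡ z ℤ.* + pⁿ → ofℚ q ≡ ofℚ (fromℤ (+ pⁿ)) * ofℚ (fromℤ z)
    scale-ℤ {q} {Z} {z} q≡ Z≡ = trans (cong ofℚ (trans q≡ (trans (cong fromℤ (trans Z≡ (ℤP.*-comm z (+ pⁿ)))) (fromℤ-homo-* (+ pⁿ) z))))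
                                      (ofℚ-homo-* (fromℤ (+ pⁿ)) (fromℤ z))
    pⁿ*r≡1 : fromℤ (+ pⁿ) ℚ.* r ≡ 1ℚ
    pⁿ*r≡1 = trans (ℚP.*-comm (fromℤ (+ pⁿ)) r) (trans (cong (λ t → r ℚ.* fromℤ t) (sym (ℤP.*-identityʳ (+ pⁿ)))) (1/n*fromℤ[n*z]≡fromℤ[z] pⁿ (+ 1)))
    b≡pⁿr*b : b ≡ ofℚ (fromℤ (+ pⁿ)) * (ofℚ r * b)
    b≡pⁿr*b = sym (begin
      ofℚ (fromℤ (+ pⁿ)) * (ofℚ r * b)    ≡⟨ ⊛-assoc (ofℚ (fromℤ (+ pⁿ))) (ofℚ r) b ⟨
      ofℚ (fromℤ (+ pⁿ)) * ofℚ r * b      ≡⟨ cong (λ t → t * b) (ofℚ-homo-* (fromℤ (+ pⁿ)) r) ⟨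
      ofℚ (fromℤ (+ pⁿ) ℚ.* r) * b        ≡⟨ cong (λ t → ofℚ t * b) pⁿ*r≡1 ⟩
      ofℚ 1ℚ * b                          ≡⟨ ⊛-identityˡ b ⟩
      b                                   ∎)
      where open ≡-Reasoning
    conj[b]≡ : conj b ≡ ofℚ (fromℤ (+ pⁿ)) * conj (ofℚ r * b)
    conj[b]≡ = begin
      conj b                                              ≡⟨ cong conj b≡pⁿr*b ⟩
      conj (ofℚ (fromℤ (+ pⁿ)) * (ofℚ r * b))            ≡⟨ conj-⊛ (ofℚ (fromℤ (+ pⁿ))) (ofℚ r * b) ⟩
      conj (ofℚ (fromℤ (+ pⁿ))) * conj (ofℚ r * b)       ≡⟨ cong (λ t → t * conj (ofℚ r * b)) (conj-ofℚ (fromℤ (+ pⁿ))) ⟩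
      ofℚ (fromℤ (+ pⁿ)) * conj (ofℚ r * b)              ∎
      where open ≡-Reasoning

  infixr 5 _⋆_
  _⋆_ : M2 OF → Coords → Coords
  mat α β γ δ ⋆ x = coords (quad x (α , γ)) (quad x (β , δ)) (bil 1ₒ x (α , γ) (β , δ)) (bil ωₒ x (α , γ) (β , δ))

  congruence : ∀ {h x} → h HasCoords x → ∀ u → ∃[ h′ ] (((ιM u *) · toM h) · ιM u ≡ toM h′) × h′ HasCoords (u ⋆ x)
  congruence {h} {x} hx (mat α β γ δ) =
    herm (fromℤ (quad x (α , γ))) ⟨ ιᵥ (α , γ) ∣ toM h ∣ ιᵥ (β , δ) ⟩ (fromℤ (quad x (β , δ))) ,
    mat-cong (⟨⟩-diag-integral hx (α , γ)) refl (⟨⟩-conj-symmetric h (ιᵥ (α , γ)) (ιᵥ (β , δ))) (⟨⟩-diag-integral hx (β , δ)) ,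
    record { a-coord = refl ; c-coord = refl
           ; P-coord = ⟨⟩-pairing-integral hx 1ₒ (α , γ) (β , δ)
           ; Q-coord = ⟨⟩-pairing-integral hx ωₒ (α , γ) (β , δ) }

  shear : OF → M2 OF → M2 OF
  shear z (mat α β γ δ) = mat α (z ·ₒ α +ₒ β) γ (z ·ₒ γ +ₒ δ)

  ι-shear : ∀ z α β → ι (z ·ₒ α +ₒ β) ≡ ι z * ι α + ι β
  ι-shear z α β = trans (ι-+ₒ (z ·ₒ α) β) (cong (λ t → t + ι β) (ι-·ₒ z α))

  det-shear : ∀ z u → det (ιM (shear z u)) ≡ det (ιM u)
  det-shear z (mat α β γ δ) = begin
    ι α * ι (z ·ₒ γ +ₒ δ) - ι (z ·ₒ α +ₒ β) * ι γ
      ≡⟨ cong₂ (λ s t → ι α * s - t * ι γ) (ι-shear z γ δ) (ι-shear z α β) ⟩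
    ι α * (ι z * ι γ + ι δ) - (ι z * ι α + ι β) * ι γ
      ≡⟨ solve 5 (λ a b c d z → a :* (z :* c :+ d) :- (z :* a :+ b) :* c := a :* d :- b :* c) refl (ι α) (ι β) (ι γ) (ι δ) (ι z) ⟩
    ι α * ι δ - ι β * ι γ ∎
    where open ≡-Reasoning

  bil-shear : ∀ {h x} → h HasCoords x → ∀ t z α γ β δ →
    bil t x (α , γ) (z ·ₒ α +ₒ β , z ·ₒ γ +ₒ δ) ≡ quad x (α , γ) ℤ.* trₒ (t ·ₒ z) ℤ.+ bil t x (α , γ) (β , δ)
  bil-shear {h} {x} hx t z α γ β δ = fromℤ-injective (begin
    fromℤ (bil t x v (z ·ₒ α +ₒ β , z ·ₒ γ +ₒ δ))
      ≡⟨ ⟨⟩-pairing-integral hx t v (z ·ₒ α +ₒ β , z ·ₒ γ +ₒ δ) ⟨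
    ⟪ t , ιᵥ v ᴴ· toM h ∙ (ι (z ·ₒ α +ₒ β) , ι (z ·ₒ γ +ₒ δ)) ⟫
      ≡⟨ cong₂ (λ s r → ⟪ t , ιᵥ v ᴴ· toM h ∙ (s , r) ⟫) (ι-shear z α β) (ι-shear z γ δ) ⟩
    ⟪ t , ιᵥ v ᴴ· toM h ∙ (ι z * ι α + ι β , ι z * ι γ + ι δ) ⟫
      ≡⟨ cong (λ s → ⟪ t , s ⟫) (∙-linearʳ (ιᵥ v ᴴ· toM h) (ι z) (ι α) (ι γ) (ι β) (ι δ)) ⟩
    ⟪ t , ι z * ⟨ ιᵥ v ∣ toM h ∣ ιᵥ v ⟩ + E ⟫
      ≡⟨ cong (λ s → ⟪ t , ι z * s + E ⟫) (⟨⟩-diag-integral hx v) ⟩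
    Tr (ι t * (ι z * ιℤ q + E))
      ≡⟨ cong Tr (solve 4 (λ t z q e → t :* (z :* q :+ e) := q :* (t :* z) :+ t :* e) refl (ι t) (ι z) (ιℤ q) E) ⟩
    Tr (ιℤ q * (ι t * ι z) + ι t * E)
      ≡⟨ Tr-⊕ (ιℤ q * (ι t * ι z)) (ι t * E) ⟩
    Tr (ιℤ q * (ι t * ι z)) ℚ.+ ⟪ t , E ⟫
      ≡⟨ cong₂ ℚ._+_ (trans (Tr-ofℚ⊛ (fromℤ q) (ι t * ι z)) (cong (fromℤ q ℚ.*_) (trans (cong Tr (sym (ι-·ₒ t z))) (Tr-ι (t ·ₒ z)))))
                     (⟨⟩-pairing-integral hx t v (β , δ)) ⟩
    fromℤ q ℚ.* fromℤ (trₒ (t ·ₒ z)) ℚ.+ fromℤ (bil t x v (β , δ))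
      ≡⟨ trans (fromℤ-homo-+ (q ℤ.* trₒ (t ·ₒ z)) (bil t x v (β , δ))) (cong (ℚ._+ fromℤ (bil t x v (β , δ))) (fromℤ-homo-* q (trₒ (t ·ₒ z)))) ⟨
    fromℤ (q ℤ.* trₒ (t ·ₒ z) ℤ.+ bil t x v (β , δ)) ∎)
    where
    open ≡-Reasoning
    v = (α , γ)
    q = quad x v
    E = ⟨ ιᵥ v ∣ toM h ∣ ιᵥ (β , δ) ⟩

  ∣ᶜ-⋆ : ∀ {k x} → k ∣ᶜ x → ∀ u → k ∣ᶜ u ⋆ x
  ∣ᶜ-⋆ {k} {x} k∣x (mat α β γ δ) = ∣quad (α , γ) , ∣quad (β , δ) , ∣bil 1ₒ , ∣bil ωₒ
    where
    open Coords x
    k∣a = proj₁ k∣x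
    k∣c = proj₁ (proj₂ k∣x)
    k∣P = proj₁ (proj₂ (proj₂ k∣x))
    k∣Q = proj₂ (proj₂ (proj₂ k∣x))
    ∣pair : ∀ w → k ℤ∣.∣ pairₒ w P Q
    ∣pair (u + v ω') = ∣-lincomb k∣P k∣Q u v
    ∣ac : ∀ s t → k ℤ∣.∣ a ℤ.* s ℤ.+ c ℤ.* t
    ∣ac s t = ℤ∣.∣m∣n⇒∣m+n (ℤ∣.∣m⇒∣m*n s k∣a) (ℤ∣.∣m⇒∣m*n t k∣c)
    ∣quad : ∀ v → k ℤ∣.∣ quad x v
    ∣quad (α , γ) = ℤ∣.∣m∣n⇒∣m+n (∣ac (normₒ α) (normₒ γ)) (∣pair (conjₒ α ·ₒ γ))
    ∣bil : ∀ t → k ℤ∣.∣ bil t x (α , γ) (β , δ)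
    ∣bil t = ℤ∣.∣m∣n⇒∣m+n (∣ac _ _) (ℤ∣.∣m∣n⇒∣m+n (∣pair (t ·ₒ (conjₒ α ·ₒ δ))) (∣pair (conjₒ t ·ₒ (conjₒ β ·ₒ γ))))


  unimodular-first-column : ∀ {m x} → ¬ m ∣ᶜ x → ∃[ u ] SL2 u × ¬ m ℤ∣.∣ Coords.a (u ⋆ x)
  unimodular-first-column {m} {x@(coords a c P Q)} m∤x with m ℤ∣.∣? a | m ℤ∣.∣? c | m ℤ∣.∣? P | m ℤ∣.∣? Q
  ... | no m∤a | _ | _ | _ =
    mat 1ₒ 0ₒ 0ₒ 1ₒ , solve 0 (con (+ 1) :* con (+ 1) :- con (+ 0) :* con (+ 0) := con (+ 1)) refl ,
    λ m∣ → m∤a (subst (m ℤ∣.∣_) (quad[1,0] x) m∣)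
  ... | yes _ | no m∤c | _ | _ =
    mat 0ₒ (-[1+ 0 ] + (+ 0) ω') 1ₒ 0ₒ , solve 0 (con (+ 0) :* con (+ 0) :- con (-[1+ 0 ]) :* con (+ 1) := con (+ 1)) refl ,
    λ m∣ → m∤c (subst (m ℤ∣.∣_) (quad[0,1] x) m∣)
  ... | yes m∣a | yes m∣c | no m∤P | _ =
    mat 1ₒ 0ₒ 1ₒ 1ₒ , solve 0 (con (+ 1) :* con (+ 1) :- con (+ 0) :* con (+ 1) := con (+ 1)) refl ,
    λ m∣ → m∤P (ℤ∣.∣m+n∣m⇒∣n (subst (m ℤ∣.∣_) (quad[1,1] x) m∣) (ℤ∣.∣m∣n⇒∣m+n m∣a m∣c))
  ... | yes m∣a | yes m∣c | yes _ | no m∤Q =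
    mat 1ₒ 0ₒ ωₒ 1ₒ , solve 1 (λ w → con (+ 1) :* con (+ 1) :- con (+ 0) :* w := con (+ 1)) refl (ι ωₒ) ,
    λ m∣ → m∤Q (ℤ∣.∣m+n∣m⇒∣n (subst (m ℤ∣.∣_) (quad[1,ω] x) m∣) (ℤ∣.∣m∣n⇒∣m+n m∣a (ℤ∣.∣m⇒∣m*n K m∣c)))
  ... | yes m∣a | yes m∣c | yes m∣P | yes m∣Q = ⊥-elim (m∤x (m∣a , m∣c , m∣P , m∣Q))

  shear-⋆ : ∀ {h x} → h HasCoords x → ∀ z α β γ δ → let v = (α , γ) ; w = (β , δ) in
    shear z (mat α β γ δ) ⋆ x ≡ coords (quad x v) (quad x (z ·ₒ α +ₒ β , z ·ₒ γ +ₒ δ))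
                                       (quad x v ℤ.* trₒ (1ₒ ·ₒ z) ℤ.+ bil 1ₒ x v w) (quad x v ℤ.* trₒ (ωₒ ·ₒ z) ℤ.+ bil ωₒ x v w)
  shear-⋆ hx z α β γ δ = cong₂ (coords _ _) (bil-shear hx 1ₒ z α γ β δ) (bil-shear hx ωₒ z α γ β δ)

  ∣-scale : ∀ {k} A T P e → k ℤ∣.∣ A ℤ.* T ℤ.+ P → k ℤ∣.∣ (A ℤ.* e) ℤ.* T ℤ.+ P ℤ.* e
  ∣-scale A T P e k∣ = subst (_ ℤ∣.∣_) (sym (regroup A T P e)) (ℤ∣.∣m⇒∣m*n e k∣)
    where
    regroup : ∀ A T P e → (A ℤ.* e) ℤ.* T ℤ.+ P ℤ.* e ≡ (A ℤ.* T ℤ.+ P) ℤ.* e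
    regroup = ℤ-Solver.solve-∀

  off-diagonal-clearing : ∀ {p} → Prime p → ∀ n e → ¬ + p ℤ∣.∣ D → D ℤ.* D ℤ.- D ≡ + 4 ℤ.* K → ∀ {y} →
    + (p ^ e) ∣ᶜ y → ¬ + (p ^ suc e) ℤ∣.∣ Coords.a y →
    ∃[ z ] (+ (p ^ n) ℤ∣.∣ Coords.a y ℤ.* trₒ (1ₒ ·ₒ z) ℤ.+ Coords.P y) × (+ (p ^ n) ℤ∣.∣ Coords.a y ℤ.* trₒ (ωₒ ·ₒ z) ℤ.+ Coords.Q y)
  off-diagonal-clearing {p} pr n e p∤D disc {coords _ _ _ _} (divides A refl , _ , divides P refl , divides Q refl) pᵉ⁺¹∤a =
    shear-by (trace-congruences pr n disc p∤D p∤A P Q)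
    where
    p∤A : ¬ + p ℤ∣.∣ A
    p∤A (divides q refl) = pᵉ⁺¹∤a (divides q (trans (ℤP.*-assoc q (+ p) (+ (p ^ e))) (cong (q ℤ.*_) (sym (ℤP.pos-* p (p ^ e))))))
    shear-by : ∃[ zr ] ∃[ zi ] (+ (p ^ n) ℤ∣.∣ A ℤ.* (+ 2 ℤ.* zr ℤ.+ D ℤ.* zi) ℤ.+ P) ×
                               (+ (p ^ n) ℤ∣.∣ A ℤ.* (D ℤ.* zr ℤ.+ (D ℤ.* D ℤ.- + 2 ℤ.* K) ℤ.* zi) ℤ.+ Q) →
               ∃[ z ] (+ (p ^ n) ℤ∣.∣ (A ℤ.* + (p ^ e)) ℤ.* trₒ (1ₒ ·ₒ z) ℤ.+ P ℤ.* + (p ^ e)) ×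
                      (+ (p ^ n) ℤ∣.∣ (A ℤ.* + (p ^ e)) ℤ.* trₒ (ωₒ ·ₒ z) ℤ.+ Q ℤ.* + (p ^ e))
    shear-by (zr , zi , kP , kQ) =
      zr + zi ω' ,
      ∣-scale A (trₒ (1ₒ ·ₒ (zr + zi ω'))) P (+ (p ^ e)) (subst (λ T → + (p ^ n) ℤ∣.∣ A ℤ.* T ℤ.+ P) (sym (trₒ[1ₒ·ₒz] zr zi)) kP) ,
      ∣-scale A (trₒ (ωₒ ·ₒ (zr + zi ω'))) Q (+ (p ^ e)) (subst (λ T → + (p ^ n) ℤ∣.∣ A ℤ.* T ℤ.+ Q) (sym (trₒ[ωₒ·ₒz] zr zi)) kQ)

  DiagonalizableMod : SQ → ℕ → ℕ → ℕ → Set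
  DiagonalizableMod h p n N = ∃[ a ] ∃[ d ] ∃[ u ] (1 ℕ.≤ a) × (1 ℕ.≤ d) × ¬ (p ℕ∣.∣ a) × SL2 u ×
    InPowT p n ((((ιM u *) · toM h) · ιM u) ⊟ diag N a d)

  reduction : ∀ {h x p} → Prime p → ∀ n → 1 ℕ.≤ n → ¬ + p ℤ∣.∣ D → D ℤ.* D ℤ.- D ≡ + 4 ℤ.* K →
    h HasCoords x → ∀ e {N′} → ¬ p ℕ∣.∣ N′ → + (p ^ e) ∣ᶜ x → ¬ + (p ^ suc e) ∣ᶜ x →
    DiagonalizableMod h p n (p ^ e ℕ.* N′)
  reduction {h} {x} {p} pr n 1≤n p∤D disc hx e {N′} p∤N′ pᵉ∣x pᵉ⁺¹∤x = from-column (unimodular-first-column pᵉ⁺¹∤x)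
    where
    instance _ = prime⇒nonZero pr
    N = p ^ e ℕ.* N′
    from-column : ∃[ u ] SL2 u × ¬ + (p ^ suc e) ℤ∣.∣ Coords.a (u ⋆ x) → DiagonalizableMod h p n N
    from-column (u₀@(mat α β γ δ) , sl₀ , pᵉ⁺¹∤A₀) = from-shear (off-diagonal-clearing pr n e p∤D disc pᵉ∣y pᵉ⁺¹∤A₀)
      where
      pᵉ∣y = ∣ᶜ-⋆ pᵉ∣x u₀
      from-shear : ∃[ z ] (+ (p ^ n) ℤ∣.∣ Coords.a (u₀ ⋆ x) ℤ.* trₒ (1ₒ ·ₒ z) ℤ.+ Coords.P (u₀ ⋆ x)) ×
                          (+ (p ^ n) ℤ∣.∣ Coords.a (u₀ ⋆ x) ℤ.* trₒ (ωₒ ·ₒ z) ℤ.+ Coords.Q (u₀ ⋆ x)) →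
                   DiagonalizableMod h p n N
      from-shear (z , kP , kQ) = from-diagonal (congruence hx u)
                                   (diagonal-clearing pr n 1≤n e p∤N′ (proj₁ pᵉ∣y) pᵉ⁺¹∤A₀ (proj₁ (proj₂ (∣ᶜ-⋆ pᵉ∣x u))))
        where
        u = shear z u₀
        x′≡ = shear-⋆ hx z α β γ δ
        from-diagonal : ∃[ h′ ] (((ιM u *) · toM h) · ιM u ≡ toM h′) × h′ HasCoords (u ⋆ x) →
                        ∃[ a ] ∃[ d ] (1 ℕ.≤ a) × (1 ℕ.≤ d) × ¬ p ℕ∣.∣ a ×
                          (+ (p ^ n) ℤ∣.∣ Coords.a (u ⋆ x) ℤ.- + (N ℕ.* a)) × (+ (p ^ n) ℤ∣.∣ Coords.c (u ⋆ x) ℤ.- + (N ℕ.* d)) →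
                        DiagonalizableMod h p n N
        from-diagonal (h′ , X≡h′ , h′-coords) (a , d , 1≤a , 1≤d , p∤a , kA , kC) =
          a , d , u , 1≤a , 1≤d , p∤a , trans (det-shear z u₀) sl₀ ,
          subst (λ X → InPowT p n (X ⊟ diag N a d)) (sym X≡h′)
            (subst (InPowT p n) (sym (toM-⊟-diag h′ N a d))
              (InPowT-intro p n (HasCoords-⊟-diag h′-coords N a d)
                (kA , kC , subst (+ (p ^ n) ℤ∣.∣_) (sym (cong Coords.P x′≡)) kP , subst (+ (p ^ n) ℤ∣.∣_) (sym (cong Coords.Q x′≡)) kQ)))

proposition6p3 : (D : ℤ) → ImagQuadDisc D → let open Field D in
    (n : ℕ) → 1 ≤ n → (p : ℕ) → Splits p →
    (h : SQ) → InT h → ¬ (h ≡ 0S) →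
    (N : ℕ) → IsEpsilon h N →
    ∃[ a ] ∃[ d ] ∃[ u ] (1 ≤ a) × (1 ≤ d) × ¬ (p ∣ a) × SL2 u ×
      InPowT p n ((((ιM u *) · toM h) · ιM u) ⊟ diag N a d)
proposition6p3 D disc n 1≤n p split@(pr , _) h h∈T _ N (1≤N , ε) =
  let (K , Nω≡K , D²-D≡4K) = discriminant-quarter disc
      open Hermitian D K Nω≡K
      (x , hx) = InT⇒HasCoords h∈T
      (e , N′ , N≡pᵉN′ , p∤N′) = prime-power-factor pr N 1≤N
      pᵉ∣N = divides N′ (trans N≡pᵉN′ (ℕP.*-comm (p ^ e) N′))
      pᵉ⁺¹∤N = λ pᵉ⁺¹∣N → prime^[1+e]∤prime^e*m pr p∤N′ e (subst (p ^ suc e ∣_) N≡pᵉN′ pᵉ⁺¹∣N)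
  in subst (DiagonalizableMod h p n) (sym N≡pᵉN′)
       (reduction pr n 1≤n (splits⇒∤D Nω≡K D²-D≡4K split) D²-D≡4K hx e p∤N′
          (InTℓ⇒∣ᶜ pr hx e (Equivalence.to (ε p pr e) pᵉ∣N))
          (λ pᵉ⁺¹∣x → pᵉ⁺¹∤N (Equivalence.from (ε p pr (suc e)) (∣ᶜ⇒InTℓ pr hx (suc e) pᵉ⁺¹∣x))))
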